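{- The gauged system $G'=(\mathrm{PFO},\to_{\{S\downarrow,M\}},\mathsf{width})/\stackrel{*}{\leftrightarrow}_{\mathcal{T}}$ is monotone; that is, whenever $C_1,C_2$ are $\stackrel{*}{\leftrightarrow}_{\mathcal{T}}$-equivalence classes of pfo-formulas and there exist $\theta_1\in C_1$, $\theta_2\in C_2$ with $\theta_1\to_{\{S\downarrow,M\}}\theta_2$, we have $\inf\{\mathsf{width}(\theta):\theta\in C_1\}\ge\inf\{\mathsf{width}(\theta):\theta\in C_2\}$.
   Context: All formulas are relational first-order formulas; $\wedge,\vee$ are binary. A pfo-formula is a first-order formula with no negation; $\mathrm{PFO}$ is the class of all pfo-formulas; $\mathrm{free}(\psi)$ is the set of free variables of $\psi$. The width $\mathsf{width}(\phi)$ of a formula is the maximum of $|\mathrm{free}(\psi)|$ over all subformulas $\psi$ of $\phi$. Rewriting rules (applicable to any subformula occurrence; $\oplus\in\{\wedge,\vee\}$, $Q\in\{\exists,\forall\}$): $A$: $F_1\oplus(F_2\oplus F_3)\to(F_1\oplus F_2)\oplus F_3$ and its converse; $C$: $F_1\oplus F_2\to F_2\oplus F_1$; $O$: $QxQyF\to QyQxF$; $P\!\downarrow$: $\exists x(F_1\wedge F_2)\to(\exists xF_1)\wedge F_2$ and $\forall x(F_1\vee F_2)\to(\forall xF_1)\vee F_2$ whenever $x\notin\mathrm{free}(F_2)$; $P\!\uparrow$: inverse of $P\!\downarrow$; $N$: $QxF\to QyF'$ when $y\notin\mathrm{free}(F)$ and $F'$ arises from $F$ by replacing each free occurrence of $x$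 by $y$; $S\!\downarrow$: $\exists x(F_1\vee F_2)\to(\exists xF_1)\vee(\exists xF_2)$ and $\forall x(F_1\wedge F_2)\to(\forall xF_1)\wedge(\forall xF_2)$; $M$: $QxF\to F$ when $x\notin\mathrm{free}(F)$. $\mathcal{T}=\{A,C,O,P\!\downarrow,P\!\uparrow,N\}$. For a set $\mathcal{R}$ of rules, $\to_{\mathcal{R}}$ is the union of the $\to_R$; $\stackrel{*}{\leftrightarrow}_{\mathcal{R}}$ is the reflexive-transitive closure of $\to_{\mathcal{R}}$ together with its inverse. A gauged system is a triple $(D,\to,g)$ with $\to$ a binary relation on $D$ and $g:D\to\mathbb{R}$; it is monotone if $d\to e$ implies $g(d)\ge g(e)$. For an equivalence relation $\equiv$ on $D$, $(D,\to,g)/\equiv$ is the gauged system whose elements are the $\equiv$-classes, with $C\to C'$ iff some $d\in C$, $d'\in C'$ satisfy $d\to d'$, and with gauge $g(C)=\inf\{g(d):d\in C\}$. -}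

module Defs where

open import Data.Nat using (ℕ; _≟_; _⊔_; _≤_)
open import Data.Bool using (if_then_else_)
open import Data.Product using (_×_)
open import Data.Sum using (_⊎_)
open import Data.Unit using (⊤)
open import Data.List using (List; []; _∷_; _++_; filter; deduplicate; length)
open import Data.List.Membership.Propositional using (_∈_; _∉_)
open import Data.Vec using (Vec; toList)
import Data.Vec as Vec
open import Relation.Nullary using (¬?; ⌊_⌋)
open import Relation.Binary.PropositionalEquality using (_≡_)
open import Relation.Binary.Construct.Closure.Equivalence using (EqClosure)

record Signature : Set₁ where
  field
    Sym   : Set
    arity : Sym → ℕ
open Signature public

-- Variables are natural numbers (an infinite supply).
Var : Set
Var = ℕ

data Quant : Set where
  ∃' ∀' : Quant

data Conn : Set where
  ∧' ∨' : Conn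

data PFO (σ : Signature) : Set where
  atom : (R : Sym σ) → Vec Var (arity σ R) → PFO σ
  bin  : Conn → PFO σ → PFO σ → PFO σ
  qu   : Quant → Var → PFO σ → PFO σ

module _ {σ : Signature} where

  -- free variables (as a list, possibly with repetitions)
  free : PFO σ → List Var
  free (atom R xs)  = toList xs
  free (bin c φ ψ)  = free φ ++ free ψ
  free (qu q x φ)   = filter (λ w → ¬? (w ≟ x)) (free φ)

  nfree : PFO σ → ℕ
  nfree φ = length (deduplicate _≟_ (free φ))

  width : PFO σ → ℕ
  width φ@(atom R xs) = nfree φ
  width φ@(bin c ψ χ) = nfree φ ⊔ (width ψ ⊔ width χ)
  width φ@(qu q x ψ)  = nfree φ ⊔ width ψ

  rename : Var → Var → PFO σ → PFO σ
  rename x y (atom R xs) = atom R (Vec.map (λ z → if ⌊ z ≟ x ⌋ then y else z) xs)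
  rename x y (bin c φ ψ) = bin c (rename x y φ) (rename x y ψ)
  rename x y (qu q z φ)  = if ⌊ z ≟ x ⌋ then qu q z φ else qu q z (rename x y φ)

  -- y is free for x in φ: no free occurrence of x lies in the scope of a quantifier on y
  FreeFor : Var → Var → PFO σ → Set
  FreeFor y x (atom R xs) = ⊤
  FreeFor y x (bin c φ ψ) = FreeFor y x φ × FreeFor y x ψ
  FreeFor y x (qu q z φ)  = z ≡ x ⊎ ((z ≡ y → x ∉ free φ) × FreeFor y x φ)

  data RuleA : PFO σ → PFO σ → Set where
    assoc  : ∀ c F₁ F₂ F₃ → RuleA (bin c F₁ (bin c F₂ F₃)) (bin c (bin c F₁ F₂) F₃)
    assoc⁻ : ∀ c F₁ F₂ F₃ → RuleA (bin c (bin c F₁ F₂) F₃) (bin c F₁ (bin c F₂ F₃))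

  data RuleC : PFO σ → PFO σ → Set where
    comm : ∀ c F₁ F₂ → RuleC (bin c F₁ F₂) (bin c F₂ F₁)

  data RuleO : PFO σ → PFO σ → Set where
    swap : ∀ q x y F → RuleO (qu q x (qu q y F)) (qu q y (qu q x F))

  data RulePdown : PFO σ → PFO σ → Set where
    push∃ : ∀ x F₁ F₂ → x ∉ free F₂ →
            RulePdown (qu ∃' x (bin ∧' F₁ F₂)) (bin ∧' (qu ∃' x F₁) F₂)
    push∀ : ∀ x F₁ F₂ → x ∉ free F₂ →
            RulePdown (qu ∀' x (bin ∨' F₁ F₂)) (bin ∨' (qu ∀' x F₁) F₂)

  data RulePup : PFO σ → PFO σ → Set where
    pull : ∀ {F G} → RulePdown G F → RulePup F G

  data RuleN : PFO σ → PFO σ → Set where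
    ren : ∀ q x y F → y ∉ free F → FreeFor y x F →
          RuleN (qu q x F) (qu q y (rename x y F))

  data RuleSdown : PFO σ → PFO σ → Set where
    split∃ : ∀ x F₁ F₂ → RuleSdown (qu ∃' x (bin ∨' F₁ F₂)) (bin ∨' (qu ∃' x F₁) (qu ∃' x F₂))
    split∀ : ∀ x F₁ F₂ → RuleSdown (qu ∀' x (bin ∧' F₁ F₂)) (bin ∧' (qu ∀' x F₁) (qu ∀' x F₂))

  data RuleM : PFO σ → PFO σ → Set where
    drop : ∀ q x F → x ∉ free F → RuleM (qu q x F) F

  data RootT : PFO σ → PFO σ → Set where
    rA : ∀ {F G} → RuleA F G → RootT F G
    rC : ∀ {F G} → RuleC F G → RootT F G
    rO : ∀ {F G} → RuleO F G → RootT F G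
    rPd : ∀ {F G} → RulePdown F G → RootT F G
    rPu : ∀ {F G} → RulePup F G → RootT F G
    rN : ∀ {F G} → RuleN F G → RootT F G

  data RootSM : PFO σ → PFO σ → Set where
    rS : ∀ {F G} → RuleSdown F G → RootSM F G
    rM : ∀ {F G} → RuleM F G → RootSM F G

  data AtSub (R : PFO σ → PFO σ → Set) : PFO σ → PFO σ → Set where
    here  : ∀ {F G} → R F G → AtSub R F G
    left  : ∀ {c F F' G} → AtSub R F F' → AtSub R (bin c F G) (bin c F' G)
    right : ∀ {c F G G'} → AtSub R G G' → AtSub R (bin c F G) (bin c F G')
    under : ∀ {q x F F'} → AtSub R F F' → AtSub R (qu q x F) (qu q x F')

  _→T_ : PFO σ → PFO σ → Set
  _→T_ = AtSub RootT

  _→SM_ : PFO σ → PFO σ → Set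
  _→SM_ = AtSub RootSM

  _↔T_ : PFO σ → PFO σ → Set
  _↔T_ = EqClosure _→T_

  IsInfWidth : PFO σ → ℕ → Set
  IsInfWidth θ n = (∀ φ → θ ↔T φ → n ≤ width φ)
                 × (∀ m → (∀ φ → θ ↔T φ → m ≤ width φ) → m ≤ n)

-- Take the step θ₁ → θ₂ to be S↓ on ∃x(F₁ ∨ F₂) (the ∀ case is dual) or M. It can be replayed along
-- T-moves: for every φ ↔T θ₁ there is ψ ↔T θ₂ obtained from φ by a generalised step, and generalised
-- steps never increase width. P↑ may pull ∀-binders into the ∨-tree below ∃x; the generalised S↓-step
-- cuts this ∨/∀-tree in two halves, each leaf going to one half together with the ∀-binders it needs,
-- and distributes ∃x over the halves. Before that, P↓ may have moved ∃x into one operand of a conjunction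
-- whose other operand avoids x, and O past other ∃-binders.
-- A vacuous binder (rule M, or S↓ when x does not occur) can travel anywhere and is tracked on its own.
-- Widths cannot grow, since every subformula of a half has its free variables among those of the
-- subformula of φ it comes from.

module Submission where

open import Defs
open import Data.Nat using (ℕ; zero; suc; _≟_; _⊔_; _≤_; _≥_; _+_; z≤n; s≤s)
import Data.Nat.Properties as NP
import Data.List.Properties as LP
open import Data.Bool using (if_then_else_)
open import Data.Product using (Σ; _×_; _,_; proj₁; proj₂)
open import Data.Sum using (_⊎_; inj₁; inj₂)
open import Data.Unit using (⊤; tt)
open import Data.Empty using (⊥; ⊥-elim)
open import Data.List using (List; []; _∷_; _++_; filter; deduplicate; length)
open import Data.List.Extrema.Nat using (max; xs≤max)
open import Data.List.Membership.Propositional using (_∈_; _∉_)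
open import Data.List.Membership.Propositional.Properties
open import Data.List.Membership.DecPropositional _≟_ using (_∈?_)
open import Data.List.Relation.Unary.Any using (here; there; _─_)
import Data.List.Relation.Unary.All as All
open import Data.List.Relation.Unary.AllPairs using ([]; _∷_)
open import Data.List.Relation.Unary.Unique.Propositional using (Unique)
open import Data.List.Relation.Unary.Unique.DecPropositional.Properties _≟_ using (deduplicate-!)
open import Data.Vec using (Vec; toList)
import Data.Vec as Vec
open import Relation.Nullary using (¬_; yes; no; ¬?; ⌊_⌋; Dec)
open import Relation.Binary.PropositionalEquality using (_≡_; refl; sym; trans; cong; cong₂; subst; subst₂; _≢_)
import Relation.Binary.Construct.Closure.Equivalence as EC
open import Relation.Binary.Construct.Closure.ReflexiveTransitive using (ε; _◅_; _◅◅_)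
open import Relation.Binary.Construct.Closure.Symmetric using (fwd; bwd)

∈-─ : ∀ {x u : ℕ} ys (x∈ys : x ∈ ys) → u ∈ ys → u ≢ x → u ∈ (ys ─ x∈ys)
∈-─ (y ∷ ys) (here refl) (here refl)  u≢x = ⊥-elim (u≢x refl)
∈-─ (y ∷ ys) (here refl) (there u∈ys) u≢x = u∈ys
∈-─ (y ∷ ys) (there x∈ys) (here u≡y)  u≢x = here u≡y
∈-─ (y ∷ ys) (there x∈ys) (there u∈ys) u≢x = there (∈-─ ys x∈ys u∈ys u≢x)

unique⊆⇒length≤ : ∀ (xs ys : List ℕ) → Unique xs → (∀ {u} → u ∈ xs → u ∈ ys) → length xs ≤ length ys
unique⊆⇒length≤ []       ys _              _   = z≤n
unique⊆⇒length≤ (x ∷ xs) ys (x∉xs ∷ !xs) xs⊆ys =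
  subst (suc (length xs) ≤_) (sym (LP.length-removeAt′ ys _))
    (s≤s (unique⊆⇒length≤ xs (ys ─ x∈ys) !xs
      (λ u∈xs → ∈-─ ys x∈ys (xs⊆ys (there u∈xs)) (λ u≡x → All.lookup x∉xs u∈xs (sym u≡x)))))
  where x∈ys = xs⊆ys (here refl)

filter-≢-id : ∀ v (xs : List ℕ) → v ∉ xs → filter (λ w → ¬? (w ≟ v)) xs ≡ xs
filter-≢-id v [] _ = refl
filter-≢-id v (x ∷ xs) v∉ =
  trans (LP.filter-accept (λ w → ¬? (w ≟ v)) (λ x≡v → v∉ (here (sym x≡v))))
        (cong (x ∷_) (filter-≢-id v xs (λ v∈ → v∉ (there v∈))))

fresh : List ℕ → ℕ
fresh xs = suc (max 0 xs)

fresh∉ : ∀ xs → fresh xs ∉ xs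
fresh∉ xs fresh∈ = NP.1+n≰n (All.lookup (xs≤max 0 xs) fresh∈)

record FreshFrom (L : List ℕ) (a b : ℕ) : Set where
  field
    var  : ℕ
    ∉L   : var ∉ L
    ≢a   : var ≢ a
    ≢b   : var ≢ b

freshFrom : ∀ L a b → FreshFrom L a b
freshFrom L a b = record
  { var = fresh M
  ; ∉L  = λ v∈L → fresh∉ M (∈-++⁺ˡ v∈L)
  ; ≢a  = λ v≡a → fresh∉ M (∈-++⁺ʳ L (here v≡a))
  ; ≢b  = λ v≡b → fresh∉ M (∈-++⁺ʳ L (there (here v≡b)))
  }
  where M = L ++ a ∷ b ∷ []

renVar : Var → Var → Var → Var
renVar x y z = if ⌊ z ≟ x ⌋ then y else z

renVar-≡ : ∀ x y → renVar x y x ≡ y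
renVar-≡ x y with x ≟ x
... | yes _   = refl
... | no x≢x = ⊥-elim (x≢x refl)

renVar-≢ : ∀ {x y z} → z ≢ x → renVar x y z ≡ z
renVar-≢ {x} {y} {z} z≢x with z ≟ x
... | yes z≡x = ⊥-elim (z≢x z≡x)
... | no _    = refl

renVar-self : ∀ x z → renVar x x z ≡ z
renVar-self x z with z ≟ x
... | yes z≡x = sym z≡x
... | no _    = refl

renVar-inverse : ∀ x y z → z ≢ y → renVar y x (renVar x y z) ≡ z
renVar-inverse x y z z≢y with z ≟ x
... | yes refl = renVar-≡ y z
... | no _     = renVar-≢ z≢y

map-renVar-∉ : ∀ {n} x y (xs : Vec Var n) → x ∉ toList xs → Vec.map (renVar x y) xs ≡ xs
map-renVar-∉ x y Vec.[] _ = refl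
map-renVar-∉ x y (a Vec.∷ xs) x∉ =
  cong₂ Vec._∷_ (renVar-≢ (λ a≡x → x∉ (here (sym a≡x)))) (map-renVar-∉ x y xs (λ x∈ → x∉ (there x∈)))

∈-map-renVar⁺ : ∀ {n u} x y (xs : Vec Var n) → u ≢ x → u ∈ toList xs → u ∈ toList (Vec.map (renVar x y) xs)
∈-map-renVar⁺ x y (a Vec.∷ xs) u≢x (here refl) = here (sym (renVar-≢ u≢x))
∈-map-renVar⁺ x y (a Vec.∷ xs) u≢x (there u∈) = there (∈-map-renVar⁺ x y xs u≢x u∈)

∈-map-renVar⁻ : ∀ {n u} x y (xs : Vec Var n) → u ∈ toList (Vec.map (renVar x y) xs) → u ≢ y →
                u ∈ toList xs × u ≢ x
∈-map-renVar⁻ x y (a Vec.∷ xs) (here u≡) u≢y with a ≟ x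
... | yes _   = ⊥-elim (u≢y u≡)
... | no a≢x = here u≡ , (λ u≡x → a≢x (trans (sym u≡) u≡x))
∈-map-renVar⁻ x y (a Vec.∷ xs) (there u∈) u≢y with ∈-map-renVar⁻ x y xs u∈ u≢y
... | u∈xs , u≢x = there u∈xs , u≢x

target∈map-renVar : ∀ {n} x y (xs : Vec Var n) → x ∈ toList xs → y ∈ toList (Vec.map (renVar x y) xs)
target∈map-renVar x y (a Vec.∷ xs) (here refl) = here (sym (renVar-≡ x y))
target∈map-renVar x y (a Vec.∷ xs) (there x∈) = there (target∈map-renVar x y xs x∈)

map-renVar-inverse : ∀ {n} x y (xs : Vec Var n) → y ∉ toList xs →
                     Vec.map (renVar y x) (Vec.map (renVar x y) xs) ≡ xs
map-renVar-inverse x y Vec.[] _ = refl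
map-renVar-inverse x y (a Vec.∷ xs) y∉ =
  cong₂ Vec._∷_ (renVar-inverse x y a (λ a≡y → y∉ (here (sym a≡y))))
                (map-renVar-inverse x y xs (λ y∈ → y∉ (there y∈)))

map-renVar-self : ∀ {n} x (xs : Vec Var n) → Vec.map (renVar x x) xs ≡ xs
map-renVar-self x Vec.[] = refl
map-renVar-self x (a Vec.∷ xs) = cong₂ Vec._∷_ (renVar-self x a) (map-renVar-self x xs)

module _ {σ : Signature} where

  _⊆ᶠ_ : PFO σ → PFO σ → Set
  A ⊆ᶠ B = ∀ {u} → u ∈ free A → u ∈ free B

  freeExcept : Var → PFO σ → List Var
  freeExcept x φ = filter (λ w → ¬? (w ≟ x)) (free φ)

  ∈-freeExcept⁻ : ∀ {x u} (φ : PFO σ) → u ∈ freeExcept x φ → u ∈ free φ × u ≢ x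
  ∈-freeExcept⁻ {x = x} φ u∈ = ∈-filter⁻ (λ w → ¬? (w ≟ x)) u∈

  ∈-freeExcept⁺ : ∀ {x u} (φ : PFO σ) → u ∈ free φ → u ≢ x → u ∈ freeExcept x φ
  ∈-freeExcept⁺ {x = x} φ u∈ u≢x = ∈-filter⁺ (λ w → ¬? (w ≟ x)) u∈ u≢x

  ∉-freeExcept : ∀ {x u} (φ : PFO σ) → u ∉ free φ → u ∉ freeExcept x φ
  ∉-freeExcept φ u∉ u∈ = u∉ (proj₁ (∈-freeExcept⁻ φ u∈))

  ∉-freeExcept⁻ : ∀ {x u} (φ : PFO σ) → u ∉ freeExcept x φ → u ≢ x → u ∉ free φ
  ∉-freeExcept⁻ φ u∉ u≢x u∈ = u∉ (∈-freeExcept⁺ φ u∈ u≢x)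

  bound∉freeExcept : ∀ {x} (φ : PFO σ) → x ∉ freeExcept x φ
  bound∉freeExcept φ x∈ = proj₂ (∈-freeExcept⁻ φ x∈) refl

  ∈-free-bin⁻ : ∀ {u} (φ ψ : PFO σ) → u ∈ free φ ++ free ψ → u ∈ free φ ⊎ u ∈ free ψ
  ∈-free-bin⁻ φ ψ u∈ = ∈-++⁻ (free φ) u∈

  ∈-free-binˡ : ∀ {u} (φ ψ : PFO σ) → u ∈ free φ → u ∈ free φ ++ free ψ
  ∈-free-binˡ φ ψ u∈ = ∈-++⁺ˡ u∈

  ∈-free-binʳ : ∀ {u} (φ ψ : PFO σ) → u ∈ free ψ → u ∈ free φ ++ free ψ
  ∈-free-binʳ φ ψ u∈ = ∈-++⁺ʳ (free φ) u∈

  ∉-free-bin : ∀ {u} (φ ψ : PFO σ) → u ∉ free φ → u ∉ free ψ → u ∉ free φ ++ free ψ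
  ∉-free-bin φ ψ u∉φ u∉ψ u∈ with ∈-free-bin⁻ φ ψ u∈
  ... | inj₁ u∈φ = u∉φ u∈φ
  ... | inj₂ u∈ψ = u∉ψ u∈ψ

  ∉-free-bin⁻ˡ : ∀ {u} (φ ψ : PFO σ) → u ∉ free φ ++ free ψ → u ∉ free φ
  ∉-free-bin⁻ˡ φ ψ u∉ u∈ = u∉ (∈-free-binˡ φ ψ u∈)

  ∉-free-bin⁻ʳ : ∀ {u} (φ ψ : PFO σ) → u ∉ free φ ++ free ψ → u ∉ free ψ
  ∉-free-bin⁻ʳ φ ψ u∉ u∈ = u∉ (∈-free-binʳ φ ψ u∈)

  nfree-mono : ∀ {A B : PFO σ} → A ⊆ᶠ B → nfree A ≤ nfree B
  nfree-mono {A} {B} A⊆B =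
    unique⊆⇒length≤ _ _ (deduplicate-! (free A))
      (λ u∈ → ∈-deduplicate⁺ _≟_ (A⊆B (∈-deduplicate⁻ _≟_ (free A) u∈)))

  nfree≤width : ∀ (φ : PFO σ) → nfree φ ≤ width φ
  nfree≤width (atom R xs) = NP.≤-refl
  nfree≤width (bin c φ ψ) = NP.m≤m⊔n _ _
  nfree≤width (qu q x φ)  = NP.m≤m⊔n _ _

  width≤width-qu : ∀ q x (φ : PFO σ) → width φ ≤ width (qu q x φ)
  width≤width-qu q x φ = NP.m≤n⊔m (nfree (qu q x φ)) (width φ)

  width≤width-binˡ : ∀ c (φ ψ : PFO σ) → width φ ≤ width (bin c φ ψ)
  width≤width-binˡ c φ ψ = NP.≤-trans (NP.m≤m⊔n (width φ) (width ψ)) (NP.m≤n⊔m (nfree (bin c φ ψ)) _)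

  width≤width-binʳ : ∀ c (φ ψ : PFO σ) → width ψ ≤ width (bin c φ ψ)
  width≤width-binʳ c φ ψ = NP.≤-trans (NP.m≤n⊔m (width φ) (width ψ)) (NP.m≤n⊔m (nfree (bin c φ ψ)) _)

  width-qu≤width : ∀ q x (φ : PFO σ) → width (qu q x φ) ≤ width φ
  width-qu≤width q x φ =
    NP.⊔-lub (NP.≤-trans (nfree-mono {A = qu q x φ} {B = φ} (λ u∈ → proj₁ (∈-freeExcept⁻ φ u∈))) (nfree≤width φ)) NP.≤-refl

  rename-qu-≢ : ∀ {q x y z} {φ : PFO σ} → z ≢ x → rename x y (qu q z φ) ≡ qu q z (rename x y φ)
  rename-qu-≢ {x = x} {z = z} z≢x with z ≟ x
  ... | yes z≡x = ⊥-elim (z≢x z≡x)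
  ... | no _    = refl


  rename-∉ : ∀ x y (φ : PFO σ) → x ∉ free φ → rename x y φ ≡ φ
  rename-∉ x y (atom R xs) n = cong (atom R) (map-renVar-∉ x y xs n)
  rename-∉ x y (bin c φ ψ) n = cong₂ (bin c) (rename-∉ x y φ (∉-free-bin⁻ˡ φ ψ n)) (rename-∉ x y ψ (∉-free-bin⁻ʳ φ ψ n))
  rename-∉ x y (qu q z φ) n with z ≟ x
  ... | yes refl = refl
  ... | no ne = cong (qu q z) (rename-∉ x y φ (∉-freeExcept⁻ φ n (λ e → ne (sym e))))

  rename-self : ∀ x (φ : PFO σ) → rename x x φ ≡ φ
  rename-self x (atom R xs) = cong (atom R) (map-renVar-self x xs)
  rename-self x (bin c φ ψ) = cong₂ (bin c) (rename-self x φ) (rename-self x ψ)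
  rename-self x (qu q z φ) with z ≟ x
  ... | yes refl = refl
  ... | no ne = cong (qu q z) (rename-self x φ)

  ∈-rename⁺ : ∀ {u} x y (φ : PFO σ) → u ≢ x → u ∈ free φ → u ∈ free (rename x y φ)
  ∈-rename⁺ x y (atom R xs) ne m = ∈-map-renVar⁺ x y xs ne m
  ∈-rename⁺ x y (bin c φ ψ) ne m with ∈-free-bin⁻ φ ψ m
  ... | inj₁ a = ∈-free-binˡ (rename x y φ) (rename x y ψ) (∈-rename⁺ x y φ ne a)
  ... | inj₂ b = ∈-free-binʳ (rename x y φ) (rename x y ψ) (∈-rename⁺ x y ψ ne b)
  ∈-rename⁺ x y (qu q z φ) ne m with z ≟ x
  ... | yes refl = m
  ... | no _ = ∈-freeExcept⁺ (rename x y φ) (∈-rename⁺ x y φ ne (proj₁ (∈-freeExcept⁻ φ m))) (proj₂ (∈-freeExcept⁻ φ m))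

  ∈-rename⁻ : ∀ {u} x y (φ : PFO σ) → u ∈ free (rename x y φ) → u ≢ y → u ∈ free φ × u ≢ x
  ∈-rename⁻ x y (atom R xs) m ne = ∈-map-renVar⁻ x y xs m ne
  ∈-rename⁻ x y (bin c φ ψ) m ne with ∈-free-bin⁻ (rename x y φ) (rename x y ψ) m
  ... | inj₁ a = let r = ∈-rename⁻ x y φ a ne in ∈-free-binˡ φ ψ (proj₁ r) , proj₂ r
  ... | inj₂ b = let r = ∈-rename⁻ x y ψ b ne in ∈-free-binʳ φ ψ (proj₁ r) , proj₂ r
  ∈-rename⁻ x y (qu q z φ) m ne with z ≟ x
  ... | yes refl = m , proj₂ (∈-freeExcept⁻ φ m)
  ... | no _ = let r = ∈-rename⁻ x y φ (proj₁ (∈-freeExcept⁻ (rename x y φ) m)) ne in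
               ∈-freeExcept⁺ φ (proj₁ r) (proj₂ (∈-freeExcept⁻ (rename x y φ) m)) , proj₂ r

  ∉-rename : ∀ {u} x y (φ : PFO σ) → u ∉ free φ → u ≢ y → u ∉ free (rename x y φ)
  ∉-rename x y φ n ne m = n (proj₁ (∈-rename⁻ x y φ m ne))

  source∉rename : ∀ x y (φ : PFO σ) → x ≢ y → x ∉ free (rename x y φ)
  source∉rename x y φ ne m = proj₂ (∈-rename⁻ x y φ m ne) refl

  ∉⇒FreeFor : ∀ y x (φ : PFO σ) → x ∉ free φ → FreeFor y x φ
  ∉⇒FreeFor y x (atom R xs) n = tt
  ∉⇒FreeFor y x (bin c φ ψ) n = ∉⇒FreeFor y x φ (∉-free-bin⁻ˡ φ ψ n) , ∉⇒FreeFor y x ψ (∉-free-bin⁻ʳ φ ψ n)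
  ∉⇒FreeFor y x (qu q z φ) n with z ≟ x
  ... | yes e = inj₁ e
  ... | no ne = inj₂ ((λ _ → nx) , ∉⇒FreeFor y x φ nx)
    where nx = ∉-freeExcept⁻ φ n (λ e → ne (sym e))

  target∈rename : ∀ x y (φ : PFO σ) → x ∈ free φ → FreeFor y x φ → y ∈ free (rename x y φ)
  target∈rename x y (atom R xs) m ff = target∈map-renVar x y xs m
  target∈rename x y (bin c φ ψ) m (f1 , f2) with ∈-free-bin⁻ φ ψ m
  ... | inj₁ a = ∈-free-binˡ (rename x y φ) (rename x y ψ) (target∈rename x y φ a f1)
  ... | inj₂ b = ∈-free-binʳ (rename x y φ) (rename x y ψ) (target∈rename x y ψ b f2)
  target∈rename x y (qu q z φ) m ff with z ≟ x
  ... | yes refl = ⊥-elim (bound∉freeExcept φ m)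
  target∈rename x y (qu q z φ) m (inj₁ e) | no ne = ⊥-elim (ne e)
  target∈rename x y (qu q z φ) m (inj₂ (h , ff)) | no ne =
    ∈-freeExcept⁺ (rename x y φ) (target∈rename x y φ xin ff) (λ y≡z → h (sym y≡z) xin)
    where xin = proj₁ (∈-freeExcept⁻ φ m)

  rename-inverse : ∀ x y (φ : PFO σ) → y ∉ free φ → FreeFor y x φ → rename y x (rename x y φ) ≡ φ
  rename-inverse x y (atom R xs) n ff = cong (atom R) (map-renVar-inverse x y xs n)
  rename-inverse x y (bin c φ ψ) n (f1 , f2) =
    cong₂ (bin c) (rename-inverse x y φ (∉-free-bin⁻ˡ φ ψ n) f1) (rename-inverse x y ψ (∉-free-bin⁻ʳ φ ψ n) f2)
  rename-inverse x y (qu q z φ) n ff with z ≟ x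
  rename-inverse x y (qu q z φ) n ff | yes refl with z ≟ y
  ... | yes refl = refl
  ... | no ne = cong (qu q z) (rename-∉ y z φ (∉-freeExcept⁻ φ n (λ e → ne (sym e))))
  rename-inverse x y (qu q z φ) n (inj₁ e) | no ne = ⊥-elim (ne e)
  rename-inverse x y (qu q z φ) n (inj₂ (h , ff)) | no ne with z ≟ y
  ... | yes refl = cong (qu q z) (rename-∉ x z φ (h refl))
  ... | no ne2 = cong (qu q z) (rename-inverse x y φ (∉-freeExcept⁻ φ n (λ e → ne2 (sym e))) ff)

  FreeFor-inverse : ∀ x y (φ : PFO σ) → y ∉ free φ → FreeFor y x φ → FreeFor x y (rename x y φ)
  FreeFor-inverse x y (atom R xs) n ff = tt
  FreeFor-inverse x y (bin c φ ψ) n (f1 , f2) =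
    FreeFor-inverse x y φ (∉-free-bin⁻ˡ φ ψ n) f1 , FreeFor-inverse x y ψ (∉-free-bin⁻ʳ φ ψ n) f2
  FreeFor-inverse x y (qu q z φ) n ff with z ≟ x
  FreeFor-inverse x y (qu q z φ) n ff | yes refl with z ≟ y
  ... | yes e = inj₁ e
  ... | no ne = inj₂ ((λ _ → ny) , ∉⇒FreeFor z y φ ny)
    where ny = ∉-freeExcept⁻ φ n (λ e → ne (sym e))
  FreeFor-inverse x y (qu q z φ) n (inj₁ e) | no ne = ⊥-elim (ne e)
  FreeFor-inverse x y (qu q z φ) n (inj₂ (h , ff)) | no ne with z ≟ y
  ... | yes e = inj₁ e
  ... | no ne2 = inj₂ ((λ e → ⊥-elim (ne e)) , FreeFor-inverse x y φ (∉-freeExcept⁻ φ n (λ e → ne2 (sym e))) ff)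

dual : Quant → Quant
dual ∃' = ∀'
dual ∀' = ∃'

-- The connective a quantifier crosses by rule P (∃ with ∧, ∀ with ∨); rule S distributes q over pConn (dual q).
pConn : Quant → Conn
pConn ∃' = ∧'
pConn ∀' = ∨'

_≟ᶜ_ : (a b : Conn) → Dec (a ≡ b)
∧' ≟ᶜ ∧' = yes refl
∧' ≟ᶜ ∨' = no (λ ())
∨' ≟ᶜ ∧' = no (λ ())
∨' ≟ᶜ ∨' = yes refl

_≟ᵠ_ : (a b : Quant) → Dec (a ≡ b)
∃' ≟ᵠ ∃' = yes refl
∃' ≟ᵠ ∀' = no (λ ())
∀' ≟ᵠ ∃' = no (λ ())
∀' ≟ᵠ ∀' = yes refl

pConn-injective : ∀ {a b} → pConn a ≡ pConn b → a ≡ b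
pConn-injective {∃'} {∃'} _ = refl
pConn-injective {∃'} {∀'} ()
pConn-injective {∀'} {∃'} ()
pConn-injective {∀'} {∀'} _ = refl

q≢dual : ∀ q → q ≢ dual q
q≢dual ∃' ()
q≢dual ∀' ()

pConn≢pConn-dual : ∀ q → pConn q ≢ pConn (dual q)
pConn≢pConn-dual ∃' ()
pConn≢pConn-dual ∀' ()

module _ {σ : Signature} where

  RootT-sym : ∀ {F G : PFO σ} → RootT F G → RootT G F
  RootT-sym (rA (assoc c a b d)) = rA (assoc⁻ c a b d)
  RootT-sym (rA (assoc⁻ c a b d)) = rA (assoc c a b d)
  RootT-sym (rC (comm c a b)) = rC (comm c b a)
  RootT-sym (rO (swap q x y F)) = rO (swap q y x F)
  RootT-sym (rPd p) = rPu (pull p)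
  RootT-sym (rPu (pull p)) = rPd p
  RootT-sym (rN (ren q x y F ny ff)) with x ≟ y
  ... | yes refl rewrite rename-self x F =
    subst (λ G → RootT (qu q x F) (qu q x G)) (rename-self x F) (rN (ren q x x F ny ff))
  ... | no ne =
    subst (λ G → RootT (qu q y (rename x y F)) (qu q x G)) (rename-inverse x y F ny ff)
      (rN (ren q y x (rename x y F) (source∉rename x y F ne) (FreeFor-inverse x y F ny ff)))

  →T-sym : ∀ {F G : PFO σ} → F →T G → G →T F
  →T-sym (here r) = here (RootT-sym r)
  →T-sym (left s) = left (→T-sym s)
  →T-sym (right s) = right (→T-sym s)
  →T-sym (under s) = under (→T-sym s)

  ⊆ᶠ-pushDown : ∀ q c x (F1 F2 : PFO σ) → qu q x (bin c F1 F2) ⊆ᶠ bin c (qu q x F1) F2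
  ⊆ᶠ-pushDown q c x F1 F2 u∈ with ∈-freeExcept⁻ (bin c F1 F2) u∈
  ... | u∈F , u≢x with ∈-free-bin⁻ F1 F2 u∈F
  ... | inj₁ u∈F1 = ∈-free-binˡ (qu q x F1) F2 (∈-freeExcept⁺ F1 u∈F1 u≢x)
  ... | inj₂ u∈F2 = ∈-free-binʳ (qu q x F1) F2 u∈F2

  ⊆ᶠ-pullUp : ∀ q c x (F1 F2 : PFO σ) → x ∉ free F2 → bin c (qu q x F1) F2 ⊆ᶠ qu q x (bin c F1 F2)
  ⊆ᶠ-pullUp q c x F1 F2 x∉F2 u∈ with ∈-free-bin⁻ (qu q x F1) F2 u∈
  ... | inj₁ u∈xF1 = let u∈F1 , u≢x = ∈-freeExcept⁻ F1 u∈xF1 in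
                     ∈-freeExcept⁺ (bin c F1 F2) (∈-free-binˡ F1 F2 u∈F1) u≢x
  ... | inj₂ u∈F2 = ∈-freeExcept⁺ (bin c F1 F2) (∈-free-binʳ F1 F2 u∈F2) (λ { refl → x∉F2 u∈F2 })

  RootT-⊆ᶠ : ∀ {F G : PFO σ} → RootT F G → F ⊆ᶠ G
  RootT-⊆ᶠ (rA (assoc c F1 F2 F3)) {u} m = subst (u ∈_) (sym (LP.++-assoc (free F1) (free F2) (free F3))) m
  RootT-⊆ᶠ (rA (assoc⁻ c F1 F2 F3)) {u} m = subst (u ∈_) (LP.++-assoc (free F1) (free F2) (free F3)) m
  RootT-⊆ᶠ (rC (comm c F1 F2)) m with ∈-free-bin⁻ F1 F2 m
  ... | inj₁ a = ∈-free-binʳ F2 F1 a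
  ... | inj₂ b = ∈-free-binˡ F2 F1 b
  RootT-⊆ᶠ (rO (swap q x y F)) m =
    let (m1 , n1) = ∈-freeExcept⁻ (qu q y F) m in
    let (m2 , n2) = ∈-freeExcept⁻ F m1 in
    ∈-freeExcept⁺ (qu q x F) (∈-freeExcept⁺ F m2 n1) n2
  RootT-⊆ᶠ (rPd (push∃ x F1 F2 nx)) = ⊆ᶠ-pushDown ∃' ∧' x F1 F2
  RootT-⊆ᶠ (rPd (push∀ x F1 F2 nx)) = ⊆ᶠ-pushDown ∀' ∨' x F1 F2
  RootT-⊆ᶠ (rPu (pull (push∃ x F1 F2 nx))) = ⊆ᶠ-pullUp ∃' ∧' x F1 F2 nx
  RootT-⊆ᶠ (rPu (pull (push∀ x F1 F2 nx))) = ⊆ᶠ-pullUp ∀' ∨' x F1 F2 nx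
  RootT-⊆ᶠ (rN (ren q x y F ny ff)) m =
    let (m1 , n1) = ∈-freeExcept⁻ F m in
    ∈-freeExcept⁺ (rename x y F) (∈-rename⁺ x y F n1 m1) (λ { refl → ny m1 })

  →T-⊆ᶠ : ∀ {F G : PFO σ} → F →T G → F ⊆ᶠ G
  →T-⊆ᶠ (here r) m = RootT-⊆ᶠ r m
  →T-⊆ᶠ (left {F = F} {F' = F'} {G = G} s) m with ∈-free-bin⁻ F G m
  ... | inj₁ a = ∈-free-binˡ F' G (→T-⊆ᶠ s a)
  ... | inj₂ b = ∈-free-binʳ F' G b
  →T-⊆ᶠ (right {F = F} {G = G} {G' = G'} s) m with ∈-free-bin⁻ F G m
  ... | inj₁ a = ∈-free-binˡ F G' a
  ... | inj₂ b = ∈-free-binʳ F G' (→T-⊆ᶠ s b)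
  →T-⊆ᶠ (under {F = F} {F' = F'} s) m =
    let (m1 , n1) = ∈-freeExcept⁻ F m in ∈-freeExcept⁺ F' (→T-⊆ᶠ s m1) n1

  ↔-step : ∀ {F G : PFO σ} → F →T G → F ↔T G
  ↔-step s = fwd s ◅ ε

  ↔-root : ∀ {F G : PFO σ} → RootT F G → F ↔T G
  ↔-root r = ↔-step (here r)

  infixr 5 _⟫_
  _⟫_ : ∀ {F G H : PFO σ} → F ↔T G → G ↔T H → F ↔T H
  _⟫_ = _◅◅_

  ↔-sym : ∀ {F G : PFO σ} → F ↔T G → G ↔T F
  ↔-sym = EC.symmetric _→T_

  ↔-refl : ∀ {F : PFO σ} → F ↔T F
  ↔-refl = ε

  ↔T-⊆ᶠ : ∀ {F G : PFO σ} → F ↔T G → F ⊆ᶠ G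
  ↔T-⊆ᶠ ε m = m
  ↔T-⊆ᶠ (fwd s ◅ r) m = ↔T-⊆ᶠ r (→T-⊆ᶠ s m)
  ↔T-⊆ᶠ (bwd s ◅ r) m = ↔T-⊆ᶠ r (→T-⊆ᶠ (→T-sym s) m)

  ↔T-⊇ᶠ : ∀ {F G : PFO σ} → F ↔T G → G ⊆ᶠ F
  ↔T-⊇ᶠ e = ↔T-⊆ᶠ (↔-sym e)

  ↔T-∉ : ∀ {F G : PFO σ} {u} → F ↔T G → u ∉ free F → u ∉ free G
  ↔T-∉ e n m = n (↔T-⊇ᶠ e m)

  ↔-binˡ : ∀ {c} {A A' B : PFO σ} → A ↔T A' → bin c A B ↔T bin c A' B
  ↔-binˡ {c} {B = B} = EC.gmap (λ X → bin c X B) left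

  ↔-binʳ : ∀ {c} {A B B' : PFO σ} → B ↔T B' → bin c A B ↔T bin c A B'
  ↔-binʳ {c} {A = A} = EC.gmap (λ X → bin c A X) right

  ↔-bin : ∀ {c} {A A' B B' : PFO σ} → A ↔T A' → B ↔T B' → bin c A B ↔T bin c A' B'
  ↔-bin e1 e2 = ↔-binˡ e1 ⟫ ↔-binʳ e2

  ↔-qu : ∀ {q x} {A A' : PFO σ} → A ↔T A' → qu q x A ↔T qu q x A'
  ↔-qu {q} {x} = EC.gmap (qu q x) under

  pushDown : ∀ q x (F1 F2 : PFO σ) → x ∉ free F2 → RootT (qu q x (bin (pConn q) F1 F2)) (bin (pConn q) (qu q x F1) F2)
  pushDown ∃' x F1 F2 n = rPd (push∃ x F1 F2 n)
  pushDown ∀' x F1 F2 n = rPd (push∀ x F1 F2 n)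

  pullUp : ∀ q x (F1 F2 : PFO σ) → x ∉ free F2 → RootT (bin (pConn q) (qu q x F1) F2) (qu q x (bin (pConn q) F1 F2))
  pullUp q x F1 F2 n = RootT-sym (pushDown q x F1 F2 n)


  ↔-assoc : ∀ c (F1 F2 F3 : PFO σ) → bin c F1 (bin c F2 F3) ↔T bin c (bin c F1 F2) F3
  ↔-assoc c F1 F2 F3 = ↔-root (rA (assoc c F1 F2 F3))

  ↔-comm : ∀ c (F1 F2 : PFO σ) → bin c F1 F2 ↔T bin c F2 F1
  ↔-comm c F1 F2 = ↔-root (rC (comm c F1 F2))

  ↔-swap : ∀ q x y (F : PFO σ) → qu q x (qu q y F) ↔T qu q y (qu q x F)
  ↔-swap q x y F = ↔-root (rO (swap q x y F))

  ↔-rename : ∀ q x y (F : PFO σ) → y ∉ free F → FreeFor y x F → qu q x F ↔T qu q y (rename x y F)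
  ↔-rename q x y F n ff = ↔-root (rN (ren q x y F n ff))

  ↔-rename-vacuous : ∀ q x y (F : PFO σ) → x ∉ free F → y ∉ free F → qu q x F ↔T qu q y F
  ↔-rename-vacuous q x y F nx ny = subst (λ G → qu q x F ↔T qu q y G) (rename-∉ x y F nx) (↔-rename q x y F ny (∉⇒FreeFor y x F nx))



module _ {σ : Signature} where

  -- Bounding the free variables as well makes the width bound compositional: it bounds nfree of
  -- every formula built around the witness.
  record WidthBelow (φ ψ : PFO σ) : Set where
    constructor widthBelow
    field
      witness       : PFO σ
      ↔witness      : ψ ↔T witness
      witness-width : width witness ≤ width φ
      witness-free  : witness ⊆ᶠ φ

  WidthBelow-bin : ∀ c {A A' B B' : PFO σ} → WidthBelow A A' → WidthBelow B B' → WidthBelow (bin c A B) (bin c A' B')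
  WidthBelow-bin c {A} {A'} {B} {B'} (widthBelow ψa ea wa fa) (widthBelow ψb eb wb fb) =
    widthBelow (bin c ψa ψb) (↔-bin ea eb) (NP.⊔-mono-≤ (nfree-mono {A = bin c ψa ψb} {B = bin c A B} sub) (NP.⊔-mono-≤ wa wb)) sub
    where
    sub : bin c ψa ψb ⊆ᶠ bin c A B
    sub m with ∈-free-bin⁻ ψa ψb m
    ... | inj₁ a = ∈-free-binˡ A B (fa a)
    ... | inj₂ b = ∈-free-binʳ A B (fb b)

  WidthBelow-qu : ∀ q y {A A' : PFO σ} → WidthBelow A A' → WidthBelow (qu q y A) (qu q y A')
  WidthBelow-qu q y {A} (widthBelow ψa ea wa fa) =
    widthBelow (qu q y ψa) (↔-qu ea) (NP.⊔-mono-≤ (nfree-mono {A = qu q y ψa} {B = qu q y A} sub) wa) sub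
    where
    sub : qu q y ψa ⊆ᶠ qu q y A
    sub m = let (m1 , n1) = ∈-freeExcept⁻ ψa m in ∈-freeExcept⁺ A (fa m1) n1

  WidthBelow-refl : ∀ (φ : PFO σ) → WidthBelow φ φ
  WidthBelow-refl φ = widthBelow φ ↔-refl NP.≤-refl (λ m → m)

  WidthBelow-↔ : ∀ {φ ψ ψ' : PFO σ} → WidthBelow φ ψ → ψ ↔T ψ' → WidthBelow φ ψ'
  WidthBelow-↔ (widthBelow r e w f) e' = widthBelow r (↔-sym e' ⟫ e) w f

  WidthBelow-∉ : ∀ {φ ψ : PFO σ} {u} → WidthBelow φ ψ → u ∉ free φ → u ∉ free ψ
  WidthBelow-∉ (widthBelow r e w f) u∉ u∈ = u∉ (f (↔T-⊆ᶠ e u∈))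

  WidthBelow-bind : ∀ q x {φ ψ : PFO σ} → WidthBelow φ ψ → x ∉ free ψ → WidthBelow (qu q x φ) ψ
  WidthBelow-bind q x {φ} (widthBelow r e w f) x∉ψ =
    widthBelow r e (NP.≤-trans w (width≤width-qu q x φ))
      (λ u∈ → ∈-freeExcept⁺ φ (f u∈) (λ { refl → x∉ψ (↔T-⊇ᶠ e u∈) }))

  -- Rule N applied to the source of a simulation R: the target is replaced by a ↔T-equivalent one
  -- in which the renaming is capture-free.
  record Renamed (R : PFO σ → PFO σ → Set) (z w : Var) (A ψ : PFO σ) : Set where
    constructor renamed
    field
      target         : PFO σ
      ↔target        : ψ ↔T target
      FreeFor-target : FreeFor w z target
      w∉target       : w ∉ free target
      related        : R (rename z w A) (rename z w target)

  Renamed-∉ : ∀ {R : PFO σ → PFO σ → Set} {z w A ψ} → (∀ {ψ'} → R A ψ → ψ ↔T ψ' → R A ψ') →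
              (R A ψ → WidthBelow A ψ) → R A ψ → z ∉ free A → w ∉ free A → Renamed R z w A ψ
  Renamed-∉ {R} {z} {w} {A} R-↔ R-width r z∉ w∉ with R-width r
  ... | widthBelow ψ' ψ↔ψ' _ ψ'⊆A =
    renamed ψ' ψ↔ψ' (∉⇒FreeFor w z ψ' z∉ψ') (λ w∈ → w∉ (ψ'⊆A w∈))
      (subst₂ R (sym (rename-∉ z w A z∉)) (sym (rename-∉ z w ψ' z∉ψ')) (R-↔ r ψ↔ψ'))
    where
    z∉ψ' : z ∉ free ψ'
    z∉ψ' z∈ = z∉ (ψ'⊆A z∈)

-- One half of a split formula. A half that received no leaf is remembered only by the number of
-- dual binders assigned to it; they end up as vacuous binders around whatever it is joined with.
data Piece (σ : Signature) : Set where
  binders : ℕ → Piece σ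
  formula : PFO σ → Piece σ

module _ {σ : Signature} where

  _≈_ : Piece σ → Piece σ → Set
  binders k ≈ binders l = k ≡ l
  binders k ≈ formula _ = ⊥
  formula _ ≈ binders _ = ⊥
  formula X ≈ formula Y = X ↔T Y

  ≈-refl : ∀ a → a ≈ a
  ≈-refl (binders k) = refl
  ≈-refl (formula X) = ↔-refl

  ≈-sym : ∀ {a b} → a ≈ b → b ≈ a
  ≈-sym {binders k} {binders l} e = sym e
  ≈-sym {formula X} {formula Y} e = ↔-sym e

  ≈-trans : ∀ {a b c} → a ≈ b → b ≈ c → a ≈ c
  ≈-trans {binders k} {binders l} {binders m} e f = trans e f
  ≈-trans {formula X} {formula Y} {formula Z} e f = e ⟫ f

  _∈ᵖ_ : Var → Piece σ → Set
  u ∈ᵖ binders _ = ⊥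
  u ∈ᵖ formula X = u ∈ free X

  _∉ᵖ_ : Var → Piece σ → Set
  u ∉ᵖ a = ¬ (u ∈ᵖ a)

  ≈-∈ᵖ : ∀ {a b u} → a ≈ b → u ∈ᵖ b → u ∈ᵖ a
  ≈-∈ᵖ {formula X} {formula Y} e m = ↔T-⊇ᶠ e m

  ≈-∉ᵖ : ∀ {a b u} → a ≈ b → u ∉ᵖ a → u ∉ᵖ b
  ≈-∉ᵖ e n m = n (≈-∈ᵖ e m)

  IsFormula : Piece σ → Set
  IsFormula (binders _) = ⊥
  IsFormula (formula _) = ⊤

  ≈-IsFormula : ∀ {a b} → a ≈ b → IsFormula b → IsFormula a
  ≈-IsFormula {formula X} {formula Y} e t = tt

  renameᵖ : Var → Var → Piece σ → Piece σ
  renameᵖ z w (binders k) = binders k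
  renameᵖ z w (formula X) = formula (rename z w X)

  FreeForᵖ : Var → Var → Piece σ → Set
  FreeForᵖ w z (binders k) = ⊤
  FreeForᵖ w z (formula X) = FreeFor w z X

  NoWider : Piece σ → PFO σ → Set
  NoWider (binders _) D = ⊤
  NoWider (formula X) D = width X ≤ width D

  freshFor : PFO σ → Var
  freshFor X = fresh (free X)

  freshFor-∉ : ∀ (X : PFO σ) → freshFor X ∉ free X
  freshFor-∉ X = fresh∉ (free X)

  ≡⇒≈ : ∀ {a b : Piece σ} → a ≡ b → a ≈ b
  ≡⇒≈ {a} refl = ≈-refl a

  renameᵖ-∉ : ∀ {z w} (r : Piece σ) → z ∉ᵖ r → renameᵖ z w r ≡ r
  renameᵖ-∉ (binders k) n = refl
  renameᵖ-∉ {z} {w} (formula X) n = cong formula (rename-∉ z w X n)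

  ∉-renameᵖ : ∀ {u z w} (r : Piece σ) → u ∉ᵖ r → u ≢ w → u ∉ᵖ renameᵖ z w r
  ∉-renameᵖ (binders k) n ne ()
  ∉-renameᵖ {z = z} {w} (formula X) n ne = ∉-rename z w X n ne

  ∉⇒FreeForᵖ : ∀ {z w} (r : Piece σ) → z ∉ᵖ r → FreeForᵖ w z r
  ∉⇒FreeForᵖ (binders k) n = tt
  ∉⇒FreeForᵖ {z} {w} (formula X) n = ∉⇒FreeFor w z X n

module Splitting {σ : Signature} (q : Quant) where

  sConn : Conn
  sConn = pConn (dual q)

  wrap : ℕ → Var → PFO σ → PFO σ
  wrap zero v X = X
  wrap (suc k) v X = qu (dual q) v (wrap k v X)

  ∈-wrap⁻ : ∀ {u} k v (X : PFO σ) → u ∈ free (wrap k v X) → u ∈ free X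
  ∈-wrap⁻ zero v X m = m
  ∈-wrap⁻ (suc k) v X m = ∈-wrap⁻ k v X (proj₁ (∈-freeExcept⁻ (wrap k v X) m))

  ∉-wrap : ∀ {u} k v (X : PFO σ) → u ∉ free X → u ∉ free (wrap k v X)
  ∉-wrap k v X n m = n (∈-wrap⁻ k v X m)

  free-wrap : ∀ k v (X : PFO σ) → v ∉ free X → free (wrap k v X) ≡ free X
  free-wrap zero v X n = refl
  free-wrap (suc k) v X n =
    trans (cong (λ L → filter (λ w → ¬? (w ≟ v)) L) (free-wrap k v X n)) (filter-≢-id v (free X) n)

  ∈-wrap⁺ : ∀ {u} k v (X : PFO σ) → v ∉ free X → u ∈ free X → u ∈ free (wrap k v X)
  ∈-wrap⁺ {u} k v X n m = subst (u ∈_) (sym (free-wrap k v X n)) m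

  width-wrap : ∀ k v (X : PFO σ) → v ∉ free X → width (wrap k v X) ≡ width X
  width-wrap zero v X n = refl
  width-wrap (suc k) v X n =
    trans (cong₂ _⊔_ (cong (λ L → length (deduplicate _≟_ L)) (free-wrap (suc k) v X n)) (width-wrap k v X n))
          (NP.m≤n⇒m⊔n≡n (nfree≤width X))

  wrap-rename : ∀ k {v v'} (X : PFO σ) → v ∉ free X → v' ∉ free X → wrap k v X ↔T wrap k v' X
  wrap-rename zero X n n' = ↔-refl
  wrap-rename (suc k) {v} {v'} X n n' =
    ↔-rename-vacuous (dual q) v v' (wrap k v X) (∉-wrap k v X n) (∉-wrap k v X n') ⟫ ↔-qu (wrap-rename k X n n')

  wrap-cong : ∀ k v {X Y : PFO σ} → X ↔T Y → wrap k v X ↔T wrap k v Y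
  wrap-cong zero v e = e
  wrap-cong (suc k) v e = ↔-qu (wrap-cong k v e)

  wrap-cong-rename : ∀ k {v v'} {X Y : PFO σ} → X ↔T Y → v ∉ free X → v' ∉ free Y → wrap k v X ↔T wrap k v' Y
  wrap-cong-rename k {v} e n n' = wrap-cong k v e ⟫ wrap-rename k _ (↔T-∉ e n) n'

  wrap-+ : ∀ k l v (X : PFO σ) → wrap k v (wrap l v X) ≡ wrap (k + l) v X
  wrap-+ zero l v X = refl
  wrap-+ (suc k) l v X = cong (qu (dual q) v) (wrap-+ k l v X)

  wrap-floatˡ : ∀ k v (X Y : PFO σ) → v ∉ free X → v ∉ free Y → bin sConn (wrap k v X) Y ↔T wrap k v (bin sConn X Y)
  wrap-floatˡ zero v X Y nx ny = ↔-refl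
  wrap-floatˡ (suc k) v X Y nx ny =
    ↔-root (pullUp (dual q) v (wrap k v X) Y ny) ⟫ ↔-qu (wrap-floatˡ k v X Y nx ny)

  wrap-floatʳ : ∀ k v (X Y : PFO σ) → v ∉ free X → v ∉ free Y → bin sConn X (wrap k v Y) ↔T wrap k v (bin sConn X Y)
  wrap-floatʳ k v X Y nx ny = ↔-comm sConn X (wrap k v Y) ⟫ wrap-floatˡ k v Y X ny nx ⟫ wrap-cong k v (↔-comm sConn Y X)

  wrap-swap : ∀ k v z (X : PFO σ) → qu (dual q) z (wrap k v X) ↔T wrap k v (qu (dual q) z X)
  wrap-swap zero v z X = ↔-refl
  wrap-swap (suc k) v z X = ↔-swap (dual q) z v (wrap k v X) ⟫ ↔-qu (wrap-swap k v z X)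

  wrap-wrap : ∀ k l {f1 f2 g} n (Y : PFO σ) → n ≡ k + l → f1 ∉ free Y → f2 ∉ free Y → g ∉ free Y →
        wrap k f1 (wrap l f2 Y) ↔T wrap n g Y
  wrap-wrap k l {f1} {f2} {g} n Y e n1 n2 ng =
    subst (λ Z → wrap k f1 (wrap l f2 Y) ↔T Z) (cong (λ m → wrap m g Y) (sym e))
      (wrap-rename k (wrap l f2 Y) (∉-wrap l f2 Y n1) (∉-wrap l f2 Y n2)
       ⟫ subst (λ Z → Z ↔T wrap (k + l) g Y) (sym (wrap-+ k l f2 Y)) (wrap-rename (k + l) Y n2 ng))

  -- Pending binders are attached on a variable fresh for the formula, so they stay vacuous.
  infixl 6 _⊕_
  _⊕_ : Piece σ → Piece σ → Piece σ
  binders k ⊕ binders l = binders (k + l)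
  binders k ⊕ formula Y = formula (wrap k (freshFor Y) Y)
  formula X ⊕ binders l = formula (wrap l (freshFor X) X)
  formula X ⊕ formula Y = formula (bin sConn X Y)

  bind : Var → Piece σ → Piece σ
  bind z (binders k) = binders (suc k)
  bind z (formula X) = formula (qu (dual q) z X)

  ⊕-cong : ∀ {a a' b b'} → a ≈ a' → b ≈ b' → (a ⊕ b) ≈ (a' ⊕ b')
  ⊕-cong {binders k} {binders k'} {binders l} {binders l'} e f = cong₂ _+_ e f
  ⊕-cong {binders k} {binders .k} {formula Y} {formula Y'} refl f = wrap-cong-rename k f (freshFor-∉ Y) (freshFor-∉ Y')
  ⊕-cong {formula X} {formula X'} {binders l} {binders .l} e refl = wrap-cong-rename l e (freshFor-∉ X) (freshFor-∉ X')
  ⊕-cong {formula X} {formula X'} {formula Y} {formula Y'} e f = ↔-bin e f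

  ⊕-comm : ∀ a b → (a ⊕ b) ≈ (b ⊕ a)
  ⊕-comm (binders k) (binders l) = NP.+-comm k l
  ⊕-comm (binders k) (formula Y) = ↔-refl
  ⊕-comm (formula X) (binders l) = ↔-refl
  ⊕-comm (formula X) (formula Y) = ↔-comm sConn X Y

  freshFor-wrap : ∀ k v (Y : PFO σ) → v ∉ free Y → freshFor (wrap k v Y) ∉ free Y
  freshFor-wrap k v Y n m = freshFor-∉ (wrap k v Y) (∈-wrap⁺ k v Y n m)

  ⊕-assoc : ∀ a b c → ((a ⊕ b) ⊕ c) ≈ (a ⊕ (b ⊕ c))
  ⊕-assoc (binders k) (binders l) (binders m) = NP.+-assoc k l m
  ⊕-assoc (binders k) (binders l) (formula Z) =
    ↔-sym (wrap-wrap k l (k + l) Z refl (freshFor-wrap l (freshFor Z) Z (freshFor-∉ Z)) (freshFor-∉ Z) (freshFor-∉ Z))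
  ⊕-assoc (binders k) (formula Y) (binders m) =
    wrap-wrap m k (k + m) Y (NP.+-comm k m) (freshFor-wrap k (freshFor Y) Y (freshFor-∉ Y)) (freshFor-∉ Y) (freshFor-∉ Y)
    ⟫ ↔-sym (wrap-wrap k m (k + m) Y refl (freshFor-wrap m (freshFor Y) Y (freshFor-∉ Y)) (freshFor-∉ Y) (freshFor-∉ Y))
  ⊕-assoc (binders k) (formula Y) (formula Z) =
    ↔-binˡ (wrap-rename k Y (freshFor-∉ Y) (∉-free-bin⁻ˡ Y Z (freshFor-∉ (bin sConn Y Z))))
    ⟫ wrap-floatˡ k _ Y Z (∉-free-bin⁻ˡ Y Z (freshFor-∉ (bin sConn Y Z))) (∉-free-bin⁻ʳ Y Z (freshFor-∉ (bin sConn Y Z)))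
  ⊕-assoc (formula X) (binders l) (binders m) =
    wrap-wrap m l (l + m) X (NP.+-comm l m) (freshFor-wrap l (freshFor X) X (freshFor-∉ X)) (freshFor-∉ X) (freshFor-∉ X)
  ⊕-assoc (formula X) (binders l) (formula Z) =
    ↔-binˡ (wrap-rename l X (freshFor-∉ X) (∉-free-bin⁻ˡ X Z (freshFor-∉ (bin sConn X Z))))
    ⟫ wrap-floatˡ l _ X Z (∉-free-bin⁻ˡ X Z (freshFor-∉ (bin sConn X Z))) (∉-free-bin⁻ʳ X Z (freshFor-∉ (bin sConn X Z)))
    ⟫ ↔-sym (↔-binʳ (wrap-rename l Z (freshFor-∉ Z) (∉-free-bin⁻ʳ X Z (freshFor-∉ (bin sConn X Z))))
          ⟫ wrap-floatʳ l _ X Z (∉-free-bin⁻ˡ X Z (freshFor-∉ (bin sConn X Z))) (∉-free-bin⁻ʳ X Z (freshFor-∉ (bin sConn X Z))))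
  ⊕-assoc (formula X) (formula Y) (binders m) =
    ↔-sym (↔-binʳ (wrap-rename m Y (freshFor-∉ Y) (∉-free-bin⁻ʳ X Y (freshFor-∉ (bin sConn X Y))))
        ⟫ wrap-floatʳ m _ X Y (∉-free-bin⁻ˡ X Y (freshFor-∉ (bin sConn X Y))) (∉-free-bin⁻ʳ X Y (freshFor-∉ (bin sConn X Y))))
  ⊕-assoc (formula X) (formula Y) (formula Z) = ↔-sym (↔-assoc sConn X Y Z)

  bind-cong : ∀ {a b} z → a ≈ b → bind z a ≈ bind z b
  bind-cong {binders k} {binders l} z e = cong suc e
  bind-cong {formula X} {formula Y} z e = ↔-qu e

  bind-swap : ∀ z y a → bind z (bind y a) ≈ bind y (bind z a)
  bind-swap z y (binders k) = refl
  bind-swap z y (formula X) = ↔-swap (dual q) z y X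

  ∈ᵖ-⊕⁻ : ∀ {u} a b → u ∈ᵖ (a ⊕ b) → u ∈ᵖ a ⊎ u ∈ᵖ b
  ∈ᵖ-⊕⁻ (binders k) (binders l) ()
  ∈ᵖ-⊕⁻ (binders k) (formula Y) m = inj₂ (∈-wrap⁻ k _ Y m)
  ∈ᵖ-⊕⁻ (formula X) (binders l) m = inj₁ (∈-wrap⁻ l _ X m)
  ∈ᵖ-⊕⁻ (formula X) (formula Y) m = ∈-free-bin⁻ X Y m

  ∈ᵖ-⊕⁺ˡ : ∀ {u} a b → u ∈ᵖ a → u ∈ᵖ (a ⊕ b)
  ∈ᵖ-⊕⁺ˡ (formula X) (binders l) m = ∈-wrap⁺ l _ X (freshFor-∉ X) m
  ∈ᵖ-⊕⁺ˡ (formula X) (formula Y) m = ∈-free-binˡ X Y m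

  ∉ᵖ-⊕ : ∀ {u} a b → u ∉ᵖ a → u ∉ᵖ b → u ∉ᵖ (a ⊕ b)
  ∉ᵖ-⊕ a b n1 n2 m with ∈ᵖ-⊕⁻ a b m
  ... | inj₁ x = n1 x
  ... | inj₂ y = n2 y

  ∉ᵖ-⊕⁻ˡ : ∀ {u} a b → u ∉ᵖ (a ⊕ b) → u ∉ᵖ a
  ∉ᵖ-⊕⁻ˡ a b n m = n (∈ᵖ-⊕⁺ˡ a b m)

  ∈ᵖ-bind⁻ : ∀ {u} z a → u ∈ᵖ bind z a → u ∈ᵖ a × u ≢ z
  ∈ᵖ-bind⁻ z (formula X) m = ∈-freeExcept⁻ X m

  ∉ᵖ-bind : ∀ {u} z a → u ∉ᵖ a → u ∉ᵖ bind z a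
  ∉ᵖ-bind z a n m = n (proj₁ (∈ᵖ-bind⁻ z a m))

  ∉ᵖ-bind⁻ : ∀ {u} z a → u ∉ᵖ bind z a → u ≢ z → u ∉ᵖ a
  ∉ᵖ-bind⁻ z (binders k) n ne ()
  ∉ᵖ-bind⁻ z (formula X) n ne m = n (∈-freeExcept⁺ X m ne)

  bind-⊕ : ∀ z a b → z ∉ᵖ b → (bind z a ⊕ b) ≈ bind z (a ⊕ b)
  bind-⊕ z (binders k) (binders l) nz = refl
  bind-⊕ z (binders k) (formula Y) nz =
    ↔-rename-vacuous (dual q) (freshFor Y) z (wrap k (freshFor Y) Y) (∉-wrap k _ Y (freshFor-∉ Y)) (∉-wrap k _ Y nz)
  bind-⊕ z (formula X) (binders l) nz =
    ↔-sym (wrap-swap l (freshFor X) z X ⟫ wrap-rename l (qu (dual q) z X) (∉-freeExcept X (freshFor-∉ X)) (freshFor-∉ (qu (dual q) z X)))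
  bind-⊕ z (formula X) (formula Y) nz = ↔-root (pullUp (dual q) z X Y nz)

  -- Split D a₁ a₂: D, read as a tree of sConn-connectives and (dual q)-binders over its leaves, is cut
  -- into the halves a₁ and a₂ (up to ≈). Each leaf goes to one half, each binder to a half such that
  -- the other half does not mention its variable. Rule S on q x (F₁ sConn F₂) splits allˡ F₁ and allʳ F₂.
  data Split : PFO σ → Piece σ → Piece σ → Set where
    allˡ : ∀ F → Split F (formula F) (binders 0)
    allʳ : ∀ F → Split F (binders 0) (formula F)
    split-bin : ∀ {c A B a1 a2 b1 b2} → c ≡ sConn → Split A a1 a2 → Split B b1 b2 → Split (bin c A B) (a1 ⊕ b1) (a2 ⊕ b2)
    bindˡ : ∀ {q' z A a1 a2} → q' ≡ dual q → Split A a1 a2 → z ∉ᵖ a2 → Split (qu q' z A) (bind z a1) a2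
    bindʳ : ∀ {q' z A a1 a2} → q' ≡ dual q → Split A a1 a2 → z ∉ᵖ a1 → Split (qu q' z A) a1 (bind z a2)
    split-≈ : ∀ {A a1 a2 b1 b2} → Split A a1 a2 → a1 ≈ b1 → a2 ≈ b2 → Split A b1 b2

  Split-⊆ : ∀ {D s1 s2} → Split D s1 s2 → (∀ {u} → u ∈ᵖ s1 → u ∈ free D) × (∀ {u} → u ∈ᵖ s2 → u ∈ free D)
  Split-⊆ (allˡ F) = (λ m → m) , (λ ())
  Split-⊆ (allʳ F) = (λ ()) , (λ m → m)
  Split-⊆ (split-bin {A = A} {B} {a1} {a2} {b1} {b2} e pa pb) =
    (λ m → g1 (∈ᵖ-⊕⁻ a1 b1 m)) , (λ m → g2 (∈ᵖ-⊕⁻ a2 b2 m))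
    where
    g1 : ∀ {u} → u ∈ᵖ a1 ⊎ u ∈ᵖ b1 → u ∈ free A ++ free B
    g1 (inj₁ m) = ∈-free-binˡ A B (proj₁ (Split-⊆ pa) m)
    g1 (inj₂ m) = ∈-free-binʳ A B (proj₁ (Split-⊆ pb) m)
    g2 : ∀ {u} → u ∈ᵖ a2 ⊎ u ∈ᵖ b2 → u ∈ free A ++ free B
    g2 (inj₁ m) = ∈-free-binˡ A B (proj₂ (Split-⊆ pa) m)
    g2 (inj₂ m) = ∈-free-binʳ A B (proj₂ (Split-⊆ pb) m)
  Split-⊆ (bindˡ {z = z} {A} {a1} e pa nz) =
    (λ m → let (m1 , n1) = ∈ᵖ-bind⁻ z a1 m in ∈-freeExcept⁺ A (proj₁ (Split-⊆ pa) m1) n1) ,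
    (λ m → ∈-freeExcept⁺ A (proj₂ (Split-⊆ pa) m) (λ { refl → nz m }))
  Split-⊆ (bindʳ {z = z} {A} {a1} {a2} e pa nz) =
    (λ m → ∈-freeExcept⁺ A (proj₁ (Split-⊆ pa) m) (λ { refl → nz m })) ,
    (λ m → let (m1 , n1) = ∈ᵖ-bind⁻ z a2 m in ∈-freeExcept⁺ A (proj₂ (Split-⊆ pa) m1) n1)
  Split-⊆ (split-≈ p e1 e2) = (λ m → proj₁ (Split-⊆ p) (≈-∈ᵖ e1 m)) , (λ m → proj₂ (Split-⊆ p) (≈-∈ᵖ e2 m))

  Split-∈₁ : ∀ {D s1 s2 r u} → Split D s1 s2 → s1 ≈ r → u ∈ᵖ r → u ∈ free D
  Split-∈₁ p e m = proj₁ (Split-⊆ p) (≈-∈ᵖ e m)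

  Split-∈₂ : ∀ {D s1 s2 r u} → Split D s1 s2 → s2 ≈ r → u ∈ᵖ r → u ∈ free D
  Split-∈₂ p e m = proj₂ (Split-⊆ p) (≈-∈ᵖ e m)

  Split-∉₁ : ∀ {D s1 s2 u} → Split D s1 s2 → u ∉ free D → u ∉ᵖ s1
  Split-∉₁ p n m = n (proj₁ (Split-⊆ p) m)

  Split-∉₂ : ∀ {D s1 s2 u} → Split D s1 s2 → u ∉ free D → u ∉ᵖ s2
  Split-∉₂ p n m = n (proj₂ (Split-⊆ p) m)

  Spine : PFO σ → Set
  Spine (atom R xs) = ⊥
  Spine (bin c A B) = c ≡ sConn
  Spine (qu q' z A) = q' ≡ dual q

  Split-spine : ∀ {D s1 s2} → Split D s1 s2 → IsFormula s1 → IsFormula s2 → Spine D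
  Split-spine (allˡ F) c1 ()
  Split-spine (allʳ F) () c2
  Split-spine (split-bin e pa pb) c1 c2 = e
  Split-spine (bindˡ e pa nz) c1 c2 = e
  Split-spine (bindʳ e pa nz) c1 c2 = e
  Split-spine (split-≈ p e1 e2) c1 c2 = Split-spine p (≈-IsFormula e1 c1) (≈-IsFormula e2 c2)

  LeafSplit : PFO σ → Piece σ → Piece σ → Set
  LeafSplit D s1 s2 = (s1 ≈ formula D × s2 ≈ binders 0) ⊎ (s1 ≈ binders 0 × s2 ≈ formula D)

  Split-leaf : ∀ {D s1 s2} → Split D s1 s2 → ¬ Spine D → LeafSplit D s1 s2
  Split-leaf (allˡ F) ns = inj₁ (↔-refl , refl)
  Split-leaf (allʳ F) ns = inj₂ (refl , ↔-refl)
  Split-leaf (split-bin e pa pb) ns = ⊥-elim (ns e)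
  Split-leaf (bindˡ e pa nz) ns = ⊥-elim (ns e)
  Split-leaf (bindʳ e pa nz) ns = ⊥-elim (ns e)
  Split-leaf (split-≈ p e1 e2) ns with Split-leaf p ns
  ... | inj₁ (f1 , f2) = inj₁ (≈-trans (≈-sym e1) f1 , ≈-trans (≈-sym e2) f2)
  ... | inj₂ (f1 , f2) = inj₂ (≈-trans (≈-sym e1) f1 , ≈-trans (≈-sym e2) f2)

  LeafSplit-↔ : ∀ {D E s1 s2} → LeafSplit D s1 s2 → D ↔T E → Split E s1 s2
  LeafSplit-↔ (inj₁ (f1 , f2)) e = split-≈ (allˡ _) (≈-sym (≈-trans f1 e)) (≈-sym f2)
  LeafSplit-↔ (inj₂ (f1 , f2)) e = split-≈ (allʳ _) (≈-sym f1) (≈-sym (≈-trans f2 e))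

  record SplitBin (A B : PFO σ) (s1 s2 : Piece σ) : Set where
    constructor splitBin
    field
      {a1 a2 b1 b2} : Piece σ
      pa : Split A a1 a2
      pb : Split B b1 b2
      e1 : s1 ≈ (a1 ⊕ b1)
      e2 : s2 ≈ (a2 ⊕ b2)

  Split-bin⁻ : ∀ {c A B s1 s2} → Split (bin c A B) s1 s2 → c ≡ sConn → SplitBin A B s1 s2
  Split-bin⁻ (allˡ _) refl = splitBin (allˡ _) (allˡ _) ↔-refl refl
  Split-bin⁻ (allʳ _) refl = splitBin (allʳ _) (allʳ _) refl ↔-refl
  Split-bin⁻ (split-bin e pa pb) _ = splitBin pa pb (≈-refl _) (≈-refl _)
  Split-bin⁻ (split-≈ p e1 e2) e with Split-bin⁻ p e
  ... | splitBin pa pb f1 f2 = splitBin pa pb (≈-trans (≈-sym e1) f1) (≈-trans (≈-sym e2) f2)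

  BindSide : Var → Piece σ → Piece σ → Piece σ → Piece σ → Set
  BindSide z s1 s2 a1 a2 = (s1 ≈ bind z a1 × s2 ≈ a2 × z ∉ᵖ a2) ⊎ (s1 ≈ a1 × s2 ≈ bind z a2 × z ∉ᵖ a1)

  record SplitQu (z : Var) (A : PFO σ) (s1 s2 : Piece σ) : Set where
    constructor splitQu
    field
      {a1 a2} : Piece σ
      pa : Split A a1 a2
      tag : BindSide z s1 s2 a1 a2

  Split-qu⁻ : ∀ {q' z A s1 s2} → Split (qu q' z A) s1 s2 → q' ≡ dual q → SplitQu z A s1 s2
  Split-qu⁻ (allˡ _) refl = splitQu (allˡ _) (inj₁ (↔-refl , refl , (λ ())))
  Split-qu⁻ (allʳ _) refl = splitQu (allʳ _) (inj₂ (refl , ↔-refl , (λ ())))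
  Split-qu⁻ (bindˡ e pa nz) _ = splitQu pa (inj₁ (≈-refl _ , ≈-refl _ , nz))
  Split-qu⁻ (bindʳ e pa nz) _ = splitQu pa (inj₂ (≈-refl _ , ≈-refl _ , nz))
  Split-qu⁻ (split-≈ p e1 e2) e with Split-qu⁻ p e
  ... | splitQu pa (inj₁ (f1 , f2 , nz)) = splitQu pa (inj₁ (≈-trans (≈-sym e1) f1 , ≈-trans (≈-sym e2) f2 , nz))
  ... | splitQu pa (inj₂ (f1 , f2 , nz)) = splitQu pa (inj₂ (≈-trans (≈-sym e1) f1 , ≈-trans (≈-sym e2) f2 , nz))

  record PieceWidth (s : Piece σ) (D : PFO σ) : Set where
    constructor pieceWidth
    field
      r : Piece σ
      e : s ≈ r
      wb : NoWider r D
      fs : ∀ {u} → u ∈ᵖ r → u ∈ free D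

  NoWider-⊕ : ∀ {c} (A B : PFO σ) ra rb → NoWider ra A → NoWider rb B →
           (∀ {u} → u ∈ᵖ ra → u ∈ free A) → (∀ {u} → u ∈ᵖ rb → u ∈ free B) → NoWider (ra ⊕ rb) (bin c A B)
  NoWider-⊕ A B (binders k) (binders l) wa wb fa fb = tt
  NoWider-⊕ {c} A B (binders k) (formula Y) wa wb fa fb =
    subst (_≤ width (bin c A B)) (sym (width-wrap k _ Y (freshFor-∉ Y))) (NP.≤-trans wb (width≤width-binʳ c A B))
  NoWider-⊕ {c} A B (formula X) (binders l) wa wb fa fb =
    subst (_≤ width (bin c A B)) (sym (width-wrap l _ X (freshFor-∉ X))) (NP.≤-trans wa (width≤width-binˡ c A B))
  NoWider-⊕ {c} A B (formula X) (formula Y) wa wb fa fb =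
    NP.⊔-mono-≤ (nfree-mono {A = bin sConn X Y} {B = bin c A B} sub) (NP.⊔-mono-≤ wa wb)
    where
    sub : bin sConn X Y ⊆ᶠ bin c A B
    sub m with ∈-free-bin⁻ X Y m
    ... | inj₁ a = ∈-free-binˡ A B (fa a)
    ... | inj₂ b = ∈-free-binʳ A B (fb b)

  NoWider-bind : ∀ {q'} z (A : PFO σ) ra → NoWider ra A → (∀ {u} → u ∈ᵖ ra → u ∈ free A) → NoWider (bind z ra) (qu q' z A)
  NoWider-bind z A (binders k) wa fa = tt
  NoWider-bind {q'} z A (formula X) wa fa =
    NP.⊔-mono-≤ (nfree-mono {A = qu (dual q) z X} {B = qu q' z A} (λ m → let (m1 , n1) = ∈-freeExcept⁻ X m in ∈-freeExcept⁺ A (fa m1) n1)) wa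

  NoWider-mono : ∀ r (A B : PFO σ) → width A ≤ width B → NoWider r A → NoWider r B
  NoWider-mono (binders k) A B le w = tt
  NoWider-mono (formula X) A B le w = NP.≤-trans w le

  PieceWidth-≈ : ∀ {s s' D} → s ≈ s' → PieceWidth s D → PieceWidth s' D
  PieceWidth-≈ f (pieceWidth r e wb fs) = pieceWidth r (≈-trans (≈-sym f) e) wb fs

  Split-width : ∀ {D s1 s2} → Split D s1 s2 → PieceWidth s1 D × PieceWidth s2 D
  Split-width (allˡ F) = pieceWidth (formula F) ↔-refl NP.≤-refl (λ m → m) , pieceWidth (binders 0) refl tt (λ ())
  Split-width (allʳ F) = pieceWidth (binders 0) refl tt (λ ()) , pieceWidth (formula F) ↔-refl NP.≤-refl (λ m → m)
  Split-width (split-bin {c} {A} {B} e pa pb) with Split-width pa | Split-width pb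
  ... | (pieceWidth ra1 ea1 wa1 fa1 , pieceWidth ra2 ea2 wa2 fa2) | (pieceWidth rb1 eb1 wb1 fb1 , pieceWidth rb2 eb2 wb2 fb2) =
    pieceWidth (ra1 ⊕ rb1) (⊕-cong ea1 eb1) (NoWider-⊕ A B ra1 rb1 wa1 wb1 fa1 fb1) (fsb ra1 rb1 fa1 fb1) ,
    pieceWidth (ra2 ⊕ rb2) (⊕-cong ea2 eb2) (NoWider-⊕ A B ra2 rb2 wa2 wb2 fa2 fb2) (fsb ra2 rb2 fa2 fb2)
    where
    fsb : ∀ ra rb → (∀ {u} → u ∈ᵖ ra → u ∈ free A) → (∀ {u} → u ∈ᵖ rb → u ∈ free B) →
          ∀ {u} → u ∈ᵖ (ra ⊕ rb) → u ∈ free (bin c A B)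
    fsb ra rb fa fb m with ∈ᵖ-⊕⁻ ra rb m
    ... | inj₁ x = ∈-free-binˡ A B (fa x)
    ... | inj₂ y = ∈-free-binʳ A B (fb y)
  Split-width (bindˡ {q'} {z} {A} e pa nz) with Split-width pa
  ... | (pieceWidth r1 e1 w1 f1 , pieceWidth r2 e2 w2 f2) =
    pieceWidth (bind z r1) (bind-cong z e1) (NoWider-bind z A r1 w1 f1)
        (λ m → let (m1 , n1) = ∈ᵖ-bind⁻ z r1 m in ∈-freeExcept⁺ A (f1 m1) n1) ,
    pieceWidth r2 e2 (NoWider-mono r2 A (qu q' z A) (width≤width-qu q' z A) w2)
        (λ m → ∈-freeExcept⁺ A (f2 m) (λ { refl → nz (≈-∈ᵖ e2 m) }))
  Split-width (bindʳ {q'} {z} {A} e pa nz) with Split-width pa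
  ... | (pieceWidth r1 e1 w1 f1 , pieceWidth r2 e2 w2 f2) =
    pieceWidth r1 e1 (NoWider-mono r1 A (qu q' z A) (width≤width-qu q' z A) w1)
        (λ m → ∈-freeExcept⁺ A (f1 m) (λ { refl → nz (≈-∈ᵖ e1 m) })) ,
    pieceWidth (bind z r2) (bind-cong z e2) (NoWider-bind z A r2 w2 f2)
        (λ m → let (m1 , n1) = ∈ᵖ-bind⁻ z r2 m in ∈-freeExcept⁺ A (f2 m1) n1)
  Split-width (split-≈ p e1 e2) with Split-width p
  ... | (w1 , w2) = PieceWidth-≈ e1 w1 , PieceWidth-≈ e2 w2

  ≈-formula : ∀ {X r} → formula X ≈ r → Σ (PFO σ) (λ R → r ≡ formula R)
  ≈-formula {r = formula R} e = R , refl

  split-width : ∀ {D X Y} v → Split D (formula X) (formula Y) → WidthBelow D (bin sConn (qu q v X) (qu q v Y))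
  split-width {D} v p with Split-width p
  ... | (pieceWidth r1 e1 w1 f1 , pieceWidth r2 e2 w2 f2) with ≈-formula e1 | ≈-formula e2
  ... | (R1 , refl) | (R2 , refl) =
    widthBelow (bin sConn (qu q v R1) (qu q v R2)) (↔-bin (↔-qu e1) (↔-qu e2))
       (NP.⊔-lub (NP.≤-trans (nfree-mono {A = bin sConn (qu q v R1) (qu q v R2)} {B = D} ⊆D) (nfree≤width D))
                 (NP.⊔-lub (NP.≤-trans (width-qu≤width q v R1) w1) (NP.≤-trans (width-qu≤width q v R2) w2)))
       ⊆D
    where
    ⊆D : bin sConn (qu q v R1) (qu q v R2) ⊆ᶠ D
    ⊆D u∈ with ∈-free-bin⁻ (qu q v R1) (qu q v R2) u∈
    ... | inj₁ u∈₁ = f1 (proj₁ (∈-freeExcept⁻ R1 u∈₁))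
    ... | inj₂ u∈₂ = f2 (proj₁ (∈-freeExcept⁻ R2 u∈₂))

  Split-cast : ∀ {D E s1 s1' s2 s2'} → D ≡ E → s1 ≡ s1' → s2 ≡ s2' → Split D s1 s2 → Split E s1' s2'
  Split-cast refl refl refl p = p

  rename-wrap : ∀ {z w g} k (X : PFO σ) → g ≢ z → rename z w (wrap k g X) ≡ wrap k g (rename z w X)
  rename-wrap zero X ne = refl
  rename-wrap (suc k) X ne = trans (rename-qu-≢ ne) (cong (qu (dual q) _) (rename-wrap k X ne))

  FreeFor-wrap : ∀ {z w g} k (X : PFO σ) → g ≢ w → FreeFor w z X → FreeFor w z (wrap k g X)
  FreeFor-wrap zero X ne f = f
  FreeFor-wrap (suc k) X ne f = inj₂ ((λ e → ⊥-elim (ne e)) , FreeFor-wrap k X ne f)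

  -- _⊕_ with the pending binders on a given variable. Unlike the one chosen by _⊕_, it can be kept
  -- distinct from the variables of a renaming, so that renaming commutes with join (renameᵖ-join).
  join : Var → Piece σ → Piece σ → Piece σ
  join g (binders k) (binders l) = binders (k + l)
  join g (binders k) (formula Y) = formula (wrap k g Y)
  join g (formula X) (binders l) = formula (wrap l g X)
  join g (formula X) (formula Y) = formula (bin sConn X Y)

  ⊕≈join : ∀ g a b → g ∉ᵖ a → g ∉ᵖ b → (a ⊕ b) ≈ join g a b
  ⊕≈join g (binders k) (binders l) na nb = refl
  ⊕≈join g (binders k) (formula Y) na nb = wrap-rename k Y (freshFor-∉ Y) nb
  ⊕≈join g (formula X) (binders l) na nb = wrap-rename l X (freshFor-∉ X) na
  ⊕≈join g (formula X) (formula Y) na nb = ↔-refl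

  FreeForᵖ-join : ∀ {z w} g a b → g ≢ w → FreeForᵖ w z a → FreeForᵖ w z b → FreeForᵖ w z (join g a b)
  FreeForᵖ-join g (binders k) (binders l) ne fa fb = tt
  FreeForᵖ-join g (binders k) (formula Y) ne fa fb = FreeFor-wrap k Y ne fb
  FreeForᵖ-join g (formula X) (binders l) ne fa fb = FreeFor-wrap l X ne fa
  FreeForᵖ-join g (formula X) (formula Y) ne fa fb = fa , fb

  renameᵖ-join : ∀ {z w} g a b → g ≢ z → g ≢ w → g ∉ᵖ a → g ∉ᵖ b →
             (renameᵖ z w a ⊕ renameᵖ z w b) ≈ renameᵖ z w (join g a b)
  renameᵖ-join g (binders k) (binders l) nz nw na nb = refl
  renameᵖ-join {z} {w} g (binders k) (formula Y) nz nw na nb =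
    subst (λ T → wrap k (freshFor (rename z w Y)) (rename z w Y) ↔T T) (sym (rename-wrap k Y nz))
      (wrap-rename k (rename z w Y) (freshFor-∉ (rename z w Y)) (∉-rename z w Y nb nw))
  renameᵖ-join {z} {w} g (formula X) (binders l) nz nw na nb =
    subst (λ T → wrap l (freshFor (rename z w X)) (rename z w X) ↔T T) (sym (rename-wrap l X nz))
      (wrap-rename l (rename z w X) (freshFor-∉ (rename z w X)) (∉-rename z w X na nw))
  renameᵖ-join g (formula X) (formula Y) nz nw na nb = ↔-refl

  renameᵖ-bind : ∀ {z w y} r → y ≢ z → renameᵖ z w (bind y r) ≡ bind y (renameᵖ z w r)
  renameᵖ-bind (binders k) ne = refl
  renameᵖ-bind (formula X) ne = cong formula (rename-qu-≢ ne)

  FreeForᵖ-bind : ∀ {z w y} r → y ≢ w → FreeForᵖ w z r → FreeForᵖ w z (bind y r)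
  FreeForᵖ-bind (binders k) ne f = tt
  FreeForᵖ-bind (formula X) ne f = inj₂ ((λ e → ⊥-elim (ne e)) , f)

  -- Rule N inside the spine: the split survives the renaming once its halves are replaced by
  -- ≈-equivalent ones in which the renaming is capture-free.
  record RenamedSplit (z w : Var) (D : PFO σ) (s1 s2 : Piece σ) : Set where
    constructor renamedSplit
    field
      r1 r2 : Piece σ
      e1 : s1 ≈ r1
      e2 : s2 ≈ r2
      f1 : FreeForᵖ w z r1
      f2 : FreeForᵖ w z r2
      pr : Split (rename z w D) (renameᵖ z w r1) (renameᵖ z w r2)

  Split-rename-trivial : ∀ {z w D s1 s2} → Split D s1 s2 → z ∉ free D → RenamedSplit z w D s1 s2
  Split-rename-trivial {z} {w} {D} {s1} {s2} p n =
    renamedSplit s1 s2 (≈-refl _) (≈-refl _) (∉⇒FreeForᵖ s1 (Split-∉₁ p n)) (∉⇒FreeForᵖ s2 (Split-∉₂ p n))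
       (Split-cast (sym (rename-∉ z w D n)) (sym (renameᵖ-∉ s1 (Split-∉₁ p n))) (sym (renameᵖ-∉ s2 (Split-∉₂ p n))) p)

  Split-rename : ∀ {z w D s1 s2} → Split D s1 s2 → FreeFor w z D → w ∉ free D → RenamedSplit z w D s1 s2
  Split-rename (allˡ F) ff nw = renamedSplit (formula F) (binders 0) ↔-refl refl ff tt (allˡ _)
  Split-rename (allʳ F) ff nw = renamedSplit (binders 0) (formula F) refl ↔-refl tt ff (allʳ _)
  Split-rename (split-≈ p e1 e2) ff nw with Split-rename p ff nw
  ... | renamedSplit r1 r2 g1 g2 f1 f2 pr = renamedSplit r1 r2 (≈-trans (≈-sym e1) g1) (≈-trans (≈-sym e2) g2) f1 f2 pr
  Split-rename {z} {w} (split-bin {c} {A} {B} e pa pb) (ffa , ffb) nw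
    with Split-rename pa ffa (∉-free-bin⁻ˡ A B nw) | Split-rename pb ffb (∉-free-bin⁻ʳ A B nw)
  ... | renamedSplit ra1 ra2 ea1 ea2 fa1 fa2 pra | renamedSplit rb1 rb2 eb1 eb2 fb1 fb2 prb =
    renamedSplit (join g ra1 rb1) (join g ra2 rb2)
       (≈-trans (⊕-cong ea1 eb1) (⊕≈join g ra1 rb1 (na (Split-∈₁ pa ea1)) (nb (Split-∈₁ pb eb1))))
       (≈-trans (⊕-cong ea2 eb2) (⊕≈join g ra2 rb2 (na (Split-∈₂ pa ea2)) (nb (Split-∈₂ pb eb2))))
       (FreeForᵖ-join g ra1 rb1 gw fa1 fb1) (FreeForᵖ-join g ra2 rb2 gw fa2 fb2)
       (split-≈ (split-bin e pra prb) (renameᵖ-join g ra1 rb1 gz gw (na (Split-∈₁ pa ea1)) (nb (Split-∈₁ pb eb1)))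
                          (renameᵖ-join g ra2 rb2 gz gw (na (Split-∈₂ pa ea2)) (nb (Split-∈₂ pb eb2))))
    where
    open FreshFrom (freshFrom (free (bin c A B)) z w) renaming (var to g; ∉L to gD; ≢a to gz; ≢b to gw)
    na : ∀ {r} → (∀ {u} → u ∈ᵖ r → u ∈ free A) → g ∉ᵖ r
    na h m = gD (∈-free-binˡ A B (h m))
    nb : ∀ {r} → (∀ {u} → u ∈ᵖ r → u ∈ free B) → g ∉ᵖ r
    nb h m = gD (∈-free-binʳ A B (h m))
  Split-rename {z} {w} (bindˡ {q'} {y} {A} {a1} {a2} e pa ny) ff nw with y ≟ z
  ... | yes refl = Split-rename-trivial (bindˡ e pa ny) (bound∉freeExcept A)
  Split-rename {z} {w} (bindˡ {q'} {y} {A} {a1} {a2} e pa ny) (inj₁ yz) nw | no ne = ⊥-elim (ne yz)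
  Split-rename {z} {w} (bindˡ {q'} {y} {A} {a1} {a2} e pa ny) (inj₂ (h , ffA)) nw | no ne with y ≟ w
  ... | yes refl = Split-rename-trivial (bindˡ e pa ny) (∉-freeExcept A (h refl))
  ... | no nyw with Split-rename pa ffA (∉-freeExcept⁻ A nw (λ e → nyw (sym e)))
  ... | renamedSplit r1 r2 e1 e2 f1 f2 pr =
    renamedSplit (bind y r1) r2 (bind-cong y e1) e2 (FreeForᵖ-bind r1 nyw f1) f2
       (Split-cast (sym (rename-qu-≢ ne)) (sym (renameᵖ-bind r1 ne)) refl (bindˡ e pr (∉-renameᵖ r2 (≈-∉ᵖ e2 ny) nyw)))
  Split-rename {z} {w} (bindʳ {q'} {y} {A} {a1} {a2} e pa ny) ff nw with y ≟ z
  ... | yes refl = Split-rename-trivial (bindʳ e pa ny) (bound∉freeExcept A)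
  Split-rename {z} {w} (bindʳ {q'} {y} {A} {a1} {a2} e pa ny) (inj₁ yz) nw | no ne = ⊥-elim (ne yz)
  Split-rename {z} {w} (bindʳ {q'} {y} {A} {a1} {a2} e pa ny) (inj₂ (h , ffA)) nw | no ne with y ≟ w
  ... | yes refl = Split-rename-trivial (bindʳ e pa ny) (∉-freeExcept A (h refl))
  ... | no nyw with Split-rename pa ffA (∉-freeExcept⁻ A nw (λ e → nyw (sym e)))
  ... | renamedSplit r1 r2 e1 e2 f1 f2 pr =
    renamedSplit r1 (bind y r2) e1 (bind-cong y e2) f1 (FreeForᵖ-bind r2 nyw f2)
       (Split-cast (sym (rename-qu-≢ ne)) refl (sym (renameᵖ-bind r2 ne)) (bindʳ e pr (∉-renameᵖ r1 (≈-∉ᵖ e1 ny) nyw)))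

  spine? : (D : PFO σ) → Dec (Spine D)
  spine? (atom R xs) = no (λ ())
  spine? (bin c A B) = c ≟ᶜ sConn
  spine? (qu q' z A) = q' ≟ᵠ (dual q)

  Split-assoc : ∀ {c F1 F2 F3 s1 s2} → c ≡ sConn → Split (bin c F1 (bin c F2 F3)) s1 s2 → Split (bin c (bin c F1 F2) F3) s1 s2
  Split-assoc sp p with Split-bin⁻ p sp
  ... | splitBin {a1} {a2} p1 p23 e1 e2 with Split-bin⁻ p23 sp
  ... | splitBin {x1} {x2} {y1} {y2} p2 p3 f1 f2 =
    split-≈ (split-bin sp (split-bin sp p1 p2) p3)
       (≈-sym (≈-trans e1 (≈-trans (⊕-cong (≈-refl a1) f1) (≈-sym (⊕-assoc a1 x1 y1)))))
       (≈-sym (≈-trans e2 (≈-trans (⊕-cong (≈-refl a2) f2) (≈-sym (⊕-assoc a2 x2 y2)))))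

  Split-assoc⁻ : ∀ {c F1 F2 F3 s1 s2} → c ≡ sConn → Split (bin c (bin c F1 F2) F3) s1 s2 → Split (bin c F1 (bin c F2 F3)) s1 s2
  Split-assoc⁻ sp p with Split-bin⁻ p sp
  ... | splitBin {a1} {a2} {b1} {b2} p12 p3 e1 e2 with Split-bin⁻ p12 sp
  ... | splitBin {x1} {x2} {y1} {y2} p1 p2 f1 f2 =
    split-≈ (split-bin sp p1 (split-bin sp p2 p3))
       (≈-sym (≈-trans e1 (≈-trans (⊕-cong f1 (≈-refl b1)) (⊕-assoc x1 y1 b1))))
       (≈-sym (≈-trans e2 (≈-trans (⊕-cong f2 (≈-refl b2)) (⊕-assoc x2 y2 b2))))

  Split-comm : ∀ {c F1 F2 s1 s2} → c ≡ sConn → Split (bin c F1 F2) s1 s2 → Split (bin c F2 F1) s1 s2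
  Split-comm sp p with Split-bin⁻ p sp
  ... | splitBin {a1} {a2} {b1} {b2} p1 p2 e1 e2 =
    split-≈ (split-bin sp p2 p1) (≈-sym (≈-trans e1 (⊕-comm a1 b1))) (≈-sym (≈-trans e2 (⊕-comm a2 b2)))

  Split-pullUp : ∀ {q'' x F1 F2 s1 s2} → pConn q'' ≡ sConn → x ∉ free F2 →
        Split (bin (pConn q'') (qu q'' x F1) F2) s1 s2 → Split (qu q'' x (bin (pConn q'') F1 F2)) s1 s2
  Split-pullUp {x = x} sp nx p with Split-bin⁻ p sp
  ... | splitBin {a1} {a2} {b1} {b2} pL p2 e1 e2 with Split-qu⁻ pL (pConn-injective sp)
  ... | splitQu {u1} {u2} p1 (inj₁ (g1 , g2 , nz)) =
    split-≈ (bindˡ (pConn-injective sp) (split-bin sp p1 p2) (∉ᵖ-⊕ u2 b2 nz (Split-∉₂ p2 nx)))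
       (≈-sym (≈-trans e1 (≈-trans (⊕-cong g1 (≈-refl b1)) (bind-⊕ x u1 b1 (Split-∉₁ p2 nx)))))
       (≈-sym (≈-trans e2 (⊕-cong g2 (≈-refl b2))))
  ... | splitQu {u1} {u2} p1 (inj₂ (g1 , g2 , nz)) =
    split-≈ (bindʳ (pConn-injective sp) (split-bin sp p1 p2) (∉ᵖ-⊕ u1 b1 nz (Split-∉₁ p2 nx)))
       (≈-sym (≈-trans e1 (⊕-cong g1 (≈-refl b1))))
       (≈-sym (≈-trans e2 (≈-trans (⊕-cong g2 (≈-refl b2)) (bind-⊕ x u2 b2 (Split-∉₂ p2 nx)))))

  Split-pushDown : ∀ {q'' x F1 F2 s1 s2} → q'' ≡ dual q → x ∉ free F2 →
        Split (qu q'' x (bin (pConn q'') F1 F2)) s1 s2 → Split (bin (pConn q'') (qu q'' x F1) F2) s1 s2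
  Split-pushDown {x = x} sp nx p with Split-qu⁻ p sp
  ... | splitQu {a1} {a2} pin tag with Split-bin⁻ pin (cong pConn sp)
  ... | splitBin {u1} {u2} {v1} {v2} p1 p2 f1 f2 with tag
  ... | inj₁ (g1 , g2 , nz) =
    split-≈ (split-bin (cong pConn sp) (bindˡ sp p1 (∉ᵖ-⊕⁻ˡ u2 v2 (≈-∉ᵖ f2 nz))) p2)
       (≈-sym (≈-trans g1 (≈-trans (bind-cong x f1) (≈-sym (bind-⊕ x u1 v1 (Split-∉₁ p2 nx))))))
       (≈-sym (≈-trans g2 f2))
  ... | inj₂ (g1 , g2 , nz) =
    split-≈ (split-bin (cong pConn sp) (bindʳ sp p1 (∉ᵖ-⊕⁻ˡ u1 v1 (≈-∉ᵖ f1 nz))) p2)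
       (≈-sym (≈-trans g1 f1))
       (≈-sym (≈-trans g2 (≈-trans (bind-cong x f2) (≈-sym (bind-⊕ x u2 v2 (Split-∉₂ p2 nx))))))

  Split-swap : ∀ {q' z y F s1 s2} → q' ≡ dual q → Split (qu q' z (qu q' y F)) s1 s2 → Split (qu q' y (qu q' z F)) s1 s2
  Split-swap {z = z} {y} sp p with z ≟ y
  ... | yes refl = p
  ... | no zy with Split-qu⁻ p sp
  ... | splitQu {a1} {a2} pin tagO with Split-qu⁻ pin sp
  ... | splitQu {b1} {b2} pF tagI with tagO | tagI
  ... | inj₁ (e1 , e2 , nz) | inj₁ (f1 , f2 , ny) =
    split-≈ (bindˡ sp (bindˡ sp pF (≈-∉ᵖ f2 nz)) ny)
       (≈-sym (≈-trans e1 (≈-trans (bind-cong z f1) (bind-swap z y b1)))) (≈-sym (≈-trans e2 f2))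
  ... | inj₁ (e1 , e2 , nz) | inj₂ (f1 , f2 , ny) =
    split-≈ (bindʳ sp (bindˡ sp pF (∉ᵖ-bind⁻ y b2 (≈-∉ᵖ f2 nz) zy)) (∉ᵖ-bind z b1 ny))
       (≈-sym (≈-trans e1 (bind-cong z f1))) (≈-sym (≈-trans e2 f2))
  ... | inj₂ (e1 , e2 , nz) | inj₁ (f1 , f2 , ny) =
    split-≈ (bindˡ sp (bindʳ sp pF (∉ᵖ-bind⁻ y b1 (≈-∉ᵖ f1 nz) zy)) (∉ᵖ-bind z b2 ny))
       (≈-sym (≈-trans e1 f1)) (≈-sym (≈-trans e2 (bind-cong z f2)))
  ... | inj₂ (e1 , e2 , nz) | inj₂ (f1 , f2 , ny) =
    split-≈ (bindʳ sp (bindʳ sp pF (≈-∉ᵖ f1 nz)) ny)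
       (≈-sym (≈-trans e1 f1)) (≈-sym (≈-trans e2 (≈-trans (bind-cong z f2) (bind-swap z y b2))))

  bind-rename : ∀ {z w} r → w ∉ᵖ r → FreeForᵖ w z r → bind z r ≈ bind w (renameᵖ z w r)
  bind-rename (binders k) n f = refl
  bind-rename {z} {w} (formula X) n f = ↔-rename (dual q) z w X n f

  Split-renameBound : ∀ {q' z w A s1 s2} → q' ≡ dual q → w ∉ free A → FreeFor w z A →
       Split (qu q' z A) s1 s2 → Split (qu q' w (rename z w A)) s1 s2
  Split-renameBound {z = z} {w} {A} sp nw ff p with Split-qu⁻ p sp
  ... | splitQu {a1} {a2} pa tag with Split-rename pa ff nw
  ... | renamedSplit r1 r2 g1 g2 f1 f2 pr with tag
  ... | inj₁ (e1 , e2 , nz) =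
    split-≈ (bindˡ sp pr nw')
       (≈-sym (≈-trans e1 (≈-trans (bind-cong z g1) (bind-rename r1 (λ m → nw (Split-∈₁ pa g1 m)) f1))))
       (≈-sym (≈-trans e2 (≈-trans g2 (≡⇒≈ (sym (renameᵖ-∉ r2 (≈-∉ᵖ g2 nz)))))))
    where
    nw' : w ∉ᵖ renameᵖ z w r2
    nw' = subst (w ∉ᵖ_) (sym (renameᵖ-∉ r2 (≈-∉ᵖ g2 nz))) (λ m → nw (Split-∈₂ pa g2 m))
  ... | inj₂ (e1 , e2 , nz) =
    split-≈ (bindʳ sp pr nw')
       (≈-sym (≈-trans e1 (≈-trans g1 (≡⇒≈ (sym (renameᵖ-∉ r1 (≈-∉ᵖ g1 nz)))))))
       (≈-sym (≈-trans e2 (≈-trans (bind-cong z g2) (bind-rename r2 (λ m → nw (Split-∈₂ pa g2 m)) f2))))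
    where
    nw' : w ∉ᵖ renameᵖ z w r1
    nw' = subst (w ∉ᵖ_) (sym (renameᵖ-∉ r1 (≈-∉ᵖ g1 nz))) (λ m → nw (Split-∈₁ pa g1 m))

  mutual
    Split-→T : ∀ {D E s1 s2} → Split D s1 s2 → D →T E → Split E s1 s2
    Split-→T {D} p st with spine? D
    ... | no ns = LeafSplit-↔ (Split-leaf p ns) (↔-step st)
    ... | yes sp = Split-→T-spine p sp st

    Split-→T-spine : ∀ {D E s1 s2} → Split D s1 s2 → Spine D → D →T E → Split E s1 s2
    Split-→T-spine p sp (here (rA (assoc c F1 F2 F3))) = Split-assoc sp p
    Split-→T-spine p sp (here (rA (assoc⁻ c F1 F2 F3))) = Split-assoc⁻ sp p
    Split-→T-spine p sp (here (rC (comm c F1 F2))) = Split-comm sp p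
    Split-→T-spine p sp (here (rO (swap q' z y F))) = Split-swap sp p
    Split-→T-spine p sp (here (rPd (push∃ x F1 F2 nx))) = Split-pushDown sp nx p
    Split-→T-spine p sp (here (rPd (push∀ x F1 F2 nx))) = Split-pushDown sp nx p
    Split-→T-spine p sp (here (rPu (pull (push∃ x F1 F2 nx)))) = Split-pullUp sp nx p
    Split-→T-spine p sp (here (rPu (pull (push∀ x F1 F2 nx)))) = Split-pullUp sp nx p
    Split-→T-spine p sp (here (rN (ren q' z w A nw ff))) = Split-renameBound sp nw ff p
    Split-→T-spine p sp (left st) with Split-bin⁻ p sp
    ... | splitBin pa pb e1 e2 = split-≈ (split-bin sp (Split-→T pa st) pb) (≈-sym e1) (≈-sym e2)
    Split-→T-spine p sp (right st) with Split-bin⁻ p sp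
    ... | splitBin pa pb e1 e2 = split-≈ (split-bin sp pa (Split-→T pb st)) (≈-sym e1) (≈-sym e2)
    Split-→T-spine p sp (under st) with Split-qu⁻ p sp
    ... | splitQu pa (inj₁ (e1 , e2 , nz)) = split-≈ (bindˡ sp (Split-→T pa st) nz) (≈-sym e1) (≈-sym e2)
    ... | splitQu pa (inj₂ (e1 , e2 , nz)) = split-≈ (bindʳ sp (Split-→T pa st) nz) (≈-sym e1) (≈-sym e2)

module Distribution {σ : Signature} (q : Quant) where
  open Splitting {σ} q public

  -- Distribute x A ψ: ψ arises from q x A by distributing q x over a split, after q x has first been
  -- moved (by P↓ and O) into pConn q-operands not containing x and below other q-binders.
  data Distribute (x : Var) : PFO σ → PFO σ → Set where
    dist-split : ∀ {D X Y} → Split D (formula X) (formula Y) → x ∈ free D → Distribute x D (bin sConn (qu q x X) (qu q x Y))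
    distˡ : ∀ {c A A' H} → c ≡ pConn q → Distribute x A A' → x ∉ free H → Distribute x (bin c A H) (bin c A' H)
    distʳ : ∀ {c A A' H} → c ≡ pConn q → Distribute x A A' → x ∉ free H → Distribute x (bin c H A) (bin c H A')
    dist-qu : ∀ {q' y A A'} → q' ≡ q → y ≢ x → Distribute x A A' → Distribute x (qu q' y A) (qu q' y A')
    dist-↔ : ∀ {A ψ ψ'} → Distribute x A ψ → ψ ↔T ψ' → Distribute x A ψ'

  Distribute-cast : ∀ {x A A' ψ ψ'} → A ≡ A' → ψ ≡ ψ' → Distribute x A ψ → Distribute x A' ψ'
  Distribute-cast refl refl s = s

  Distribute-∈ : ∀ {x A ψ} → Distribute x A ψ → x ∈ free A
  Distribute-∈ (dist-split p xin) = xin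
  Distribute-∈ (distˡ {A = A} {H = H} e s n) = ∈-free-binˡ A H (Distribute-∈ s)
  Distribute-∈ (distʳ {A = A} {H = H} e s n) = ∈-free-binʳ H A (Distribute-∈ s)
  Distribute-∈ (dist-qu {A = A} e yx s) = ∈-freeExcept⁺ A (Distribute-∈ s) (λ e → yx (sym e))
  Distribute-∈ (dist-↔ s e) = Distribute-∈ s

  Distribute-≢ : ∀ {x A ψ w} → Distribute x A ψ → w ∉ free A → w ≢ x
  Distribute-≢ s w∉ refl = w∉ (Distribute-∈ s)

  Distribute-width : ∀ {x A ψ} → Distribute x A ψ → WidthBelow A ψ
  Distribute-width {x} (dist-split p x∈) = split-width x p
  Distribute-width (distˡ {c} {H = H} e s x∉) = WidthBelow-bin c (Distribute-width s) (WidthBelow-refl H)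
  Distribute-width (distʳ {c} {H = H} e s x∉) = WidthBelow-bin c (WidthBelow-refl H) (Distribute-width s)
  Distribute-width (dist-qu {q'} {y} e y≢x s) = WidthBelow-qu q' y (Distribute-width s)
  Distribute-width (dist-↔ s e) = WidthBelow-↔ (Distribute-width s) e

  Distribute-bound : ∀ {x A ψ} → Distribute x A ψ → x ∉ free ψ
  Distribute-bound (dist-split {X = X} {Y} p x∈) =
    ∉-free-bin (qu q _ X) (qu q _ Y) (bound∉freeExcept X) (bound∉freeExcept Y)
  Distribute-bound (distˡ {A' = A'} {H} e s x∉) = ∉-free-bin A' H (Distribute-bound s) x∉
  Distribute-bound (distʳ {A' = A'} {H} e s x∉) = ∉-free-bin H A' x∉ (Distribute-bound s)
  Distribute-bound (dist-qu {A' = A'} e y≢x s) = ∉-freeExcept A' (Distribute-bound s)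
  Distribute-bound (dist-↔ s e) = ↔T-∉ e (Distribute-bound s)

  Distribute-∉ : ∀ {x A ψ u} → Distribute x A ψ → u ∉ free A → u ∉ free ψ
  Distribute-∉ s = WidthBelow-∉ (Distribute-width s)

  Distribute-rename : ∀ {z w x A ψ} → Distribute x A ψ → FreeFor w z A → w ∉ free A → z ≢ x → w ≢ x →
                      Renamed (Distribute x) z w A ψ
  Distribute-rename {z} {w} {x} (dist-split {D} {X} {Y} p xin) ff nw zx wx with Split-rename p ff nw
  ... | renamedSplit r1 r2 e1 e2 f1 f2 pr with ≈-formula e1 | ≈-formula e2
  ... | (R1 , refl) | (R2 , refl) =
    renamed (bin sConn (qu q x R1) (qu q x R2)) (↔-bin (↔-qu e1) (↔-qu e2))
       (inj₂ ((λ e → ⊥-elim (wx (sym e))) , f1) , inj₂ ((λ e → ⊥-elim (wx (sym e))) , f2))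
       (∉-free-bin (qu q x R1) (qu q x R2) (∉-freeExcept R1 (λ m → nw (Split-∈₁ p e1 m))) (∉-freeExcept R2 (λ m → nw (Split-∈₂ p e2 m))))
       (Distribute-cast refl (cong₂ (bin sConn) (sym (rename-qu-≢ (λ e → zx (sym e)))) (sym (rename-qu-≢ (λ e → zx (sym e)))))
          (dist-split pr (∈-rename⁺ z w D (λ e → zx (sym e)) xin)))
  Distribute-rename {z} {w} {x} (distˡ {c} {A} {A'} {H} e s n) (ffa , ffh) nw zx wx
    with Distribute-rename s ffa (∉-free-bin⁻ˡ A H nw) zx wx
  ... | renamed ψ₁ e1 ff1 nw1 S1 =
    renamed (bin c ψ₁ H) (↔-binˡ e1) (ff1 , ffh) (∉-free-bin ψ₁ H nw1 (∉-free-bin⁻ʳ A H nw))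
       (distˡ e S1 (∉-rename z w H n (λ e → wx (sym e))))
  Distribute-rename {z} {w} {x} (distʳ {c} {A} {A'} {H} e s n) (ffh , ffa) nw zx wx
    with Distribute-rename s ffa (∉-free-bin⁻ʳ H A nw) zx wx
  ... | renamed ψ₁ e1 ff1 nw1 S1 =
    renamed (bin c H ψ₁) (↔-binʳ e1) (ffh , ff1) (∉-free-bin H ψ₁ (∉-free-bin⁻ˡ H A nw) nw1)
       (distʳ e S1 (∉-rename z w H n (λ e → wx (sym e))))
  Distribute-rename {z} {w} {x} (dist-qu {q'} {y} {A} e yx s) ff nw zx wx with y ≟ z
  ... | yes refl = Renamed-∉ dist-↔ Distribute-width (dist-qu e yx s) (bound∉freeExcept A) nw
  Distribute-rename {z} {w} {x} (dist-qu {q'} {y} {A} e yx s) (inj₁ yz) nw zx wx | no ne = ⊥-elim (ne yz)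
  Distribute-rename {z} {w} {x} (dist-qu {q'} {y} {A} e yx s) (inj₂ (h , ffA)) nw zx wx | no ne with y ≟ w
  ... | yes refl = Renamed-∉ dist-↔ Distribute-width (dist-qu e yx s) (∉-freeExcept A (h refl)) nw
  ... | no nyw with Distribute-rename s ffA (∉-freeExcept⁻ A nw (λ e → nyw (sym e))) zx wx
  ... | renamed ψ₁ e1 ff1 nw1 S1 =
    renamed (qu q' y ψ₁) (↔-qu e1) (inj₂ ((λ e → ⊥-elim (nyw e)) , ff1)) (∉-freeExcept ψ₁ nw1)
       (Distribute-cast (sym (rename-qu-≢ ne)) (sym (rename-qu-≢ ne)) (dist-qu e yx S1))
  Distribute-rename (dist-↔ s e) ff nw zx wx with Distribute-rename s ff nw zx wx
  ... | renamed ψ₁ e1 ff1 nw1 S1 = renamed ψ₁ (↔-sym e ⟫ e1) ff1 nw1 S1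

  Distribute-renameMarked : ∀ {x w A ψ} → Distribute x A ψ → FreeFor w x A → w ∉ free A → Distribute w (rename x w A) ψ
  Distribute-renameMarked {x} {w} (dist-split {D} {X} {Y} p xin) ff nw with Split-rename p ff nw
  ... | renamedSplit r1 r2 e1 e2 f1 f2 pr with ≈-formula e1 | ≈-formula e2
  ... | (R1 , refl) | (R2 , refl) =
    dist-↔ (dist-split pr (target∈rename x w D xin ff))
        (↔-sym (↔-bin (↔-rename q x w R1 (λ m → nw (Split-∈₁ p e1 m)) f1) (↔-rename q x w R2 (λ m → nw (Split-∈₂ p e2 m)) f2))
         ⟫ ↔-sym (↔-bin (↔-qu e1) (↔-qu e2)))
  Distribute-renameMarked {x} {w} (distˡ {c} {A} {A'} {H} e s n) (ffa , ffh) nw =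
    Distribute-cast (cong (bin c (rename x w A)) (sym (rename-∉ x w H n))) refl
      (distˡ e (Distribute-renameMarked s ffa (∉-free-bin⁻ˡ A H nw)) (∉-free-bin⁻ʳ A H nw))
  Distribute-renameMarked {x} {w} (distʳ {c} {A} {A'} {H} e s n) (ffh , ffa) nw =
    Distribute-cast (cong (λ T → bin c T (rename x w A)) (sym (rename-∉ x w H n))) refl
      (distʳ e (Distribute-renameMarked s ffa (∉-free-bin⁻ʳ H A nw)) (∉-free-bin⁻ˡ H A nw))
  Distribute-renameMarked {x} {w} (dist-qu {q'} {y} {A} e yx s) (inj₁ yx') nw = ⊥-elim (yx yx')
  Distribute-renameMarked {x} {w} (dist-qu {q'} {y} {A} e yx s) (inj₂ (h , ffA)) nw =
    Distribute-cast (sym (rename-qu-≢ yx)) refl (dist-qu e wy (Distribute-renameMarked s ffA (∉-freeExcept⁻ A nw (λ e → wy (sym e)))))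
    where
    wy : y ≢ w
    wy e' = h e' (Distribute-∈ s)
  Distribute-renameMarked (dist-↔ s e) ff nw = dist-↔ (Distribute-renameMarked s ff nw) e

  data DistBin (x : Var) (c : Conn) (A B ψ : PFO σ) : Set where
    distBinˡ : ∀ {A'} → c ≡ pConn q → Distribute x A A' → x ∉ free B → ψ ↔T bin c A' B → DistBin x c A B ψ
    distBinʳ : ∀ {B'} → c ≡ pConn q → Distribute x B B' → x ∉ free A → ψ ↔T bin c A B' → DistBin x c A B ψ
    distBinSplit : ∀ {X Y} → Split (bin c A B) (formula X) (formula Y) → x ∈ free (bin c A B) →
          ψ ↔T bin sConn (qu q x X) (qu q x Y) → DistBin x c A B ψ

  Distribute-bin⁻ : ∀ {x c A B ψ} → Distribute x (bin c A B) ψ → DistBin x c A B ψ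
  Distribute-bin⁻ (dist-split p xin) = distBinSplit p xin ↔-refl
  Distribute-bin⁻ (distˡ e s n) = distBinˡ e s n ↔-refl
  Distribute-bin⁻ (distʳ e s n) = distBinʳ e s n ↔-refl
  Distribute-bin⁻ (dist-↔ s e) with Distribute-bin⁻ s
  ... | distBinˡ a b c d = distBinˡ a b c (↔-sym e ⟫ d)
  ... | distBinʳ a b c d = distBinʳ a b c (↔-sym e ⟫ d)
  ... | distBinSplit a b d = distBinSplit a b (↔-sym e ⟫ d)

  data DistQu (x : Var) (q' : Quant) (y : Var) (A ψ : PFO σ) : Set where
    distQu : ∀ {A'} → q' ≡ q → y ≢ x → Distribute x A A' → ψ ↔T qu q' y A' → DistQu x q' y A ψ
    distQuSplit : ∀ {X Y} → Split (qu q' y A) (formula X) (formula Y) → x ∈ free (qu q' y A) →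
          ψ ↔T bin sConn (qu q x X) (qu q x Y) → DistQu x q' y A ψ

  Distribute-qu⁻ : ∀ {x q' y A ψ} → Distribute x (qu q' y A) ψ → DistQu x q' y A ψ
  Distribute-qu⁻ (dist-split p xin) = distQuSplit p xin ↔-refl
  Distribute-qu⁻ (dist-qu e yx s) = distQu e yx s ↔-refl
  Distribute-qu⁻ (dist-↔ s e) with Distribute-qu⁻ s
  ... | distQu a b c d = distQu a b c (↔-sym e ⟫ d)
  ... | distQuSplit a b d = distQuSplit a b (↔-sym e ⟫ d)

  dist-split-→T : ∀ {x D E X Y ψ} → Split D (formula X) (formula Y) → x ∈ free D →
                  ψ ↔T bin sConn (qu q x X) (qu q x Y) → D →T E → Distribute x E ψ
  dist-split-→T p xin e st = dist-↔ (dist-split (Split-→T p st) (→T-⊆ᶠ st xin)) (↔-sym e)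

  Distribute-pullUp : ∀ {x q'' y F1 F2 ψ} → y ∉ free F2 → RootT (bin (pConn q'') (qu q'' y F1) F2) (qu q'' y (bin (pConn q'') F1 F2)) →
         Distribute x (bin (pConn q'') (qu q'' y F1) F2) ψ → Distribute x (qu q'' y (bin (pConn q'') F1 F2)) ψ
  Distribute-pullUp {x} {q''} {y} {F1} {F2} ny r s with Distribute-bin⁻ s
  ... | distBinSplit p xin eψ = dist-split-→T p xin eψ (here r)
  ... | distBinˡ e sL n2 eψ with Distribute-qu⁻ sL
  ...   | distQu e' yx s1 eψ1 = dist-↔ (dist-qu e' yx (distˡ e s1 n2)) (↔-sym (eψ ⟫ ↔-binˡ eψ1 ⟫ ↔-root (pullUp q'' y _ F2 ny)))
  ...   | distQuSplit p' _ _ = ⊥-elim (q≢dual q (trans (sym (pConn-injective e)) (Split-spine p' tt tt)))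
  Distribute-pullUp {x} {q''} {y} {F1} {F2} ny r s | distBinʳ e s2 nL eψ =
    dist-↔ (dist-qu (pConn-injective e) yx (distʳ e s2 (∉-freeExcept⁻ F1 nL (λ e → yx (sym e)))))
        (↔-sym (eψ ⟫ ↔-root (pullUp q'' y F1 _ (Distribute-∉ s2 ny))))
    where yx = Distribute-≢ s2 ny

  Distribute-pushDown : ∀ {x q'' y F1 F2 ψ} → y ∉ free F2 → RootT (qu q'' y (bin (pConn q'') F1 F2)) (bin (pConn q'') (qu q'' y F1) F2) →
         Distribute x (qu q'' y (bin (pConn q'') F1 F2)) ψ → Distribute x (bin (pConn q'') (qu q'' y F1) F2) ψ
  Distribute-pushDown {x} {q''} {y} {F1} {F2} ny r s with Distribute-qu⁻ s
  ... | distQuSplit p xin eψ = dist-split-→T p xin eψ (here r)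
  ... | distQu e yx s' eψ with Distribute-bin⁻ s'
  ...   | distBinˡ e2 s1 n2 eψ1 = dist-↔ (distˡ e2 (dist-qu e yx s1) n2) (↔-sym (eψ ⟫ ↔-qu eψ1 ⟫ ↔-root (pushDown q'' y _ F2 ny)))
  ...   | distBinʳ e2 s2 n1 eψ2 = dist-↔ (distʳ e2 s2 (∉-freeExcept F1 n1)) (↔-sym (eψ ⟫ ↔-qu eψ2 ⟫ ↔-root (pushDown q'' y F1 _ (Distribute-∉ s2 ny))))
  ...   | distBinSplit p' _ _ = ⊥-elim (pConn≢pConn-dual q (trans (cong pConn (sym e)) (Split-spine p' tt tt)))

  Distribute-RootT : ∀ {x A A'' ψ} → Distribute x A ψ → RootT A A'' → Distribute x A'' ψ
  Distribute-RootT s r@(rA (assoc c F1 F2 F3)) with Distribute-bin⁻ s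
  ... | distBinSplit p xin eψ = dist-split-→T p xin eψ (here r)
  ... | distBinˡ e s1 n eψ = dist-↔ (distˡ e (distˡ e s1 (∉-free-bin⁻ˡ F2 F3 n)) (∉-free-bin⁻ʳ F2 F3 n)) (↔-sym (eψ ⟫ ↔-assoc c _ F2 F3))
  ... | distBinʳ e s23 n1 eψ with Distribute-bin⁻ s23
  ...   | distBinˡ e' s2 n3 eψ2 = dist-↔ (distˡ e (distʳ e s2 n1) n3) (↔-sym (eψ ⟫ ↔-binʳ eψ2 ⟫ ↔-assoc c F1 _ F3))
  ...   | distBinʳ e' s3 n2 eψ3 = dist-↔ (distʳ e s3 (∉-free-bin F1 F2 n1 n2)) (↔-sym (eψ ⟫ ↔-binʳ eψ3 ⟫ ↔-assoc c F1 F2 _))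
  ...   | distBinSplit p' _ _ = ⊥-elim (pConn≢pConn-dual q (trans (sym e) (Split-spine p' tt tt)))
  Distribute-RootT s r@(rA (assoc⁻ c F1 F2 F3)) with Distribute-bin⁻ s
  ... | distBinSplit p xin eψ = dist-split-→T p xin eψ (here r)
  ... | distBinʳ e s3 n12 eψ =
    dist-↔ (distʳ e (distʳ e s3 (∉-free-bin⁻ʳ F1 F2 n12)) (∉-free-bin⁻ˡ F1 F2 n12)) (↔-sym (eψ ⟫ ↔-sym (↔-assoc c F1 F2 _)))
  ... | distBinˡ e s12 n3 eψ with Distribute-bin⁻ s12
  ...   | distBinˡ e' s1 n2 eψ1 = dist-↔ (distˡ e s1 (∉-free-bin F2 F3 n2 n3)) (↔-sym (eψ ⟫ ↔-binˡ eψ1 ⟫ ↔-sym (↔-assoc c _ F2 F3)))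
  ...   | distBinʳ e' s2 n1 eψ2 = dist-↔ (distʳ e (distˡ e s2 n3) n1) (↔-sym (eψ ⟫ ↔-binˡ eψ2 ⟫ ↔-sym (↔-assoc c F1 _ F3)))
  ...   | distBinSplit p' _ _ = ⊥-elim (pConn≢pConn-dual q (trans (sym e) (Split-spine p' tt tt)))
  Distribute-RootT s r@(rC (comm c F1 F2)) with Distribute-bin⁻ s
  ... | distBinSplit p xin eψ = dist-split-→T p xin eψ (here r)
  ... | distBinˡ e s1 n eψ = dist-↔ (distʳ e s1 n) (↔-sym (eψ ⟫ ↔-comm c _ F2))
  ... | distBinʳ e s2 n eψ = dist-↔ (distˡ e s2 n) (↔-sym (eψ ⟫ ↔-comm c F1 _))
  Distribute-RootT s r@(rPu (pull (push∃ y F1 F2 ny))) = Distribute-pullUp ny r s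
  Distribute-RootT s r@(rPu (pull (push∀ y F1 F2 ny))) = Distribute-pullUp ny r s
  Distribute-RootT s r@(rPd (push∃ y F1 F2 ny)) = Distribute-pushDown ny r s
  Distribute-RootT s r@(rPd (push∀ y F1 F2 ny)) = Distribute-pushDown ny r s
  Distribute-RootT s r@(rO (swap q' y z F)) with Distribute-qu⁻ s
  ... | distQuSplit p xin eψ = dist-split-→T p xin eψ (here r)
  ... | distQu e yx s' eψ with Distribute-qu⁻ s'
  ...   | distQu e2 zx s2 eψ2 = dist-↔ (dist-qu e zx (dist-qu e yx s2)) (↔-sym (eψ ⟫ ↔-qu eψ2 ⟫ ↔-swap q' y z _))
  ...   | distQuSplit p' _ _ = ⊥-elim (q≢dual q (trans (sym e) (Split-spine p' tt tt)))
  Distribute-RootT {x} s r@(rN (ren q' y w A nw ff)) with Distribute-qu⁻ s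
  ... | distQuSplit p xin eψ = dist-split-→T p xin eψ (here r)
  ... | distQu e yx s' eψ with Distribute-rename s' ff nw yx (Distribute-≢ s' nw)
  ...   | renamed A₁ e1 ff1 nw1 S1 =
    dist-↔ (dist-qu e (Distribute-≢ s' nw) S1) (↔-sym (eψ ⟫ ↔-qu e1 ⟫ ↔-rename q' y w A₁ nw1 ff1))

  Distribute-→T : ∀ {x A A'' ψ} → Distribute x A ψ → A →T A'' → Distribute x A'' ψ
  Distribute-→T s (here r) = Distribute-RootT s r
  Distribute-→T s (left st) with Distribute-bin⁻ s
  ... | distBinˡ e s1 n eψ = dist-↔ (distˡ e (Distribute-→T s1 st) n) (↔-sym eψ)
  ... | distBinʳ e s2 n eψ = dist-↔ (distʳ e s2 (↔T-∉ (↔-step st) n)) (↔-sym (eψ ⟫ ↔-binˡ (↔-step st)))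
  ... | distBinSplit p xin eψ = dist-split-→T p xin eψ (left st)
  Distribute-→T s (right st) with Distribute-bin⁻ s
  ... | distBinˡ e s1 n eψ = dist-↔ (distˡ e s1 (↔T-∉ (↔-step st) n)) (↔-sym (eψ ⟫ ↔-binʳ (↔-step st)))
  ... | distBinʳ e s2 n eψ = dist-↔ (distʳ e (Distribute-→T s2 st) n) (↔-sym eψ)
  ... | distBinSplit p xin eψ = dist-split-→T p xin eψ (right st)
  Distribute-→T s (under st) with Distribute-qu⁻ s
  ... | distQu e yx s1 eψ = dist-↔ (dist-qu e yx (Distribute-→T s1 st)) (↔-sym eψ)
  ... | distQuSplit p xin eψ = dist-split-→T p xin eψ (under st)

  data SplitStep : PFO σ → PFO σ → Set where
    stepˡ : ∀ {c A A' B} → SplitStep A A' → SplitStep (bin c A B) (bin c A' B)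
    stepʳ : ∀ {c A B B'} → SplitStep B B' → SplitStep (bin c A B) (bin c A B')
    step-qu : ∀ {q' y A A'} → SplitStep A A' → SplitStep (qu q' y A) (qu q' y A')
    step-split : ∀ {q' x A ψ} → q' ≡ q → Distribute x A ψ → SplitStep (qu q' x A) ψ
    step-↔ : ∀ {φ ψ ψ'} → SplitStep φ ψ → ψ ↔T ψ' → SplitStep φ ψ'

  SplitStep-cast : ∀ {A A' ψ ψ'} → A ≡ A' → ψ ≡ ψ' → SplitStep A ψ → SplitStep A' ψ'
  SplitStep-cast refl refl s = s

  SplitStep-width : ∀ {φ ψ} → SplitStep φ ψ → WidthBelow φ ψ
  SplitStep-width (stepˡ {c} {B = B} s) = WidthBelow-bin c (SplitStep-width s) (WidthBelow-refl B)
  SplitStep-width (stepʳ {c} {A = A} s) = WidthBelow-bin c (WidthBelow-refl A) (SplitStep-width s)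
  SplitStep-width (step-qu {q'} {y} s) = WidthBelow-qu q' y (SplitStep-width s)
  SplitStep-width (step-split {q'} {x} e s) = WidthBelow-bind q' x (Distribute-width s) (Distribute-bound s)
  SplitStep-width (step-↔ s e) = WidthBelow-↔ (SplitStep-width s) e

  SplitStep-∉ : ∀ {φ ψ u} → SplitStep φ ψ → u ∉ free φ → u ∉ free ψ
  SplitStep-∉ s = WidthBelow-∉ (SplitStep-width s)

  data StepBin (c : Conn) (A B ψ : PFO σ) : Set where
    stepBinˡ : ∀ {A'} → SplitStep A A' → ψ ↔T bin c A' B → StepBin c A B ψ
    stepBinʳ : ∀ {B'} → SplitStep B B' → ψ ↔T bin c A B' → StepBin c A B ψ

  SplitStep-bin⁻ : ∀ {c A B ψ} → SplitStep (bin c A B) ψ → StepBin c A B ψ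
  SplitStep-bin⁻ (stepˡ s) = stepBinˡ s ↔-refl
  SplitStep-bin⁻ (stepʳ s) = stepBinʳ s ↔-refl
  SplitStep-bin⁻ (step-↔ s e) with SplitStep-bin⁻ s
  ... | stepBinˡ a b = stepBinˡ a (↔-sym e ⟫ b)
  ... | stepBinʳ a b = stepBinʳ a (↔-sym e ⟫ b)

  data StepQu (q' : Quant) (y : Var) (A ψ : PFO σ) : Set where
    stepQu : ∀ {A'} → SplitStep A A' → ψ ↔T qu q' y A' → StepQu q' y A ψ
    stepQuSplit : ∀ {ψ₀} → q' ≡ q → Distribute y A ψ₀ → ψ ↔T ψ₀ → StepQu q' y A ψ

  SplitStep-qu⁻ : ∀ {q' y A ψ} → SplitStep (qu q' y A) ψ → StepQu q' y A ψ
  SplitStep-qu⁻ (step-qu s) = stepQu s ↔-refl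
  SplitStep-qu⁻ (step-split e s) = stepQuSplit e s ↔-refl
  SplitStep-qu⁻ (step-↔ s e) with SplitStep-qu⁻ s
  ... | stepQu a b = stepQu a (↔-sym e ⟫ b)
  ... | stepQuSplit a b c = stepQuSplit a b (↔-sym e ⟫ c)

  SplitStep-rename : ∀ {z w A ψ} → SplitStep A ψ → FreeFor w z A → w ∉ free A → Renamed SplitStep z w A ψ
  SplitStep-rename (stepˡ {c} {A} {A'} {B} s) (ffa , ffb) nw with SplitStep-rename s ffa (∉-free-bin⁻ˡ A B nw)
  ... | renamed ψ₁ e ff1 nw1 S = renamed (bin c ψ₁ B) (↔-binˡ e) (ff1 , ffb) (∉-free-bin ψ₁ B nw1 (∉-free-bin⁻ʳ A B nw)) (stepˡ S)
  SplitStep-rename (stepʳ {c} {A} {B} {B'} s) (ffa , ffb) nw with SplitStep-rename s ffb (∉-free-bin⁻ʳ A B nw)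
  ... | renamed ψ₁ e ff1 nw1 S = renamed (bin c A ψ₁) (↔-binʳ e) (ffa , ff1) (∉-free-bin A ψ₁ (∉-free-bin⁻ˡ A B nw) nw1) (stepʳ S)
  SplitStep-rename {z} {w} (step-qu {q'} {y} {A} s) ff nw with y ≟ z
  ... | yes refl = Renamed-∉ step-↔ SplitStep-width (step-qu s) (bound∉freeExcept A) nw
  SplitStep-rename {z} {w} (step-qu {q'} {y} {A} s) (inj₁ yz) nw | no ne = ⊥-elim (ne yz)
  SplitStep-rename {z} {w} (step-qu {q'} {y} {A} s) (inj₂ (h , ffA)) nw | no ne with y ≟ w
  ... | yes refl = Renamed-∉ step-↔ SplitStep-width (step-qu s) (∉-freeExcept A (h refl)) nw
  ... | no nyw with SplitStep-rename s ffA (∉-freeExcept⁻ A nw (λ e → nyw (sym e)))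
  ... | renamed ψ₁ e1 ff1 nw1 S1 =
    renamed (qu q' y ψ₁) (↔-qu e1) (inj₂ ((λ e → ⊥-elim (nyw e)) , ff1)) (∉-freeExcept ψ₁ nw1)
       (SplitStep-cast (sym (rename-qu-≢ ne)) (sym (rename-qu-≢ ne)) (step-qu S1))
  SplitStep-rename {z} {w} (step-split {q'} {x} {A} e s) ff nw with x ≟ z
  ... | yes refl = Renamed-∉ step-↔ SplitStep-width (step-split e s) (bound∉freeExcept A) nw
  SplitStep-rename {z} {w} (step-split {q'} {x} {A} e s) (inj₁ xz) nw | no ne = ⊥-elim (ne xz)
  SplitStep-rename {z} {w} (step-split {q'} {x} {A} e s) (inj₂ (h , ffA)) nw | no ne with x ≟ w
  ... | yes refl = Renamed-∉ step-↔ SplitStep-width (step-split e s) (∉-freeExcept A (h refl)) nw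
  ... | no nxw with Distribute-rename s ffA (∉-freeExcept⁻ A nw (λ e → nxw (sym e))) (λ e → ne (sym e)) (λ e → nxw (sym e))
  ... | renamed ψ₁ e1 ff1 nw1 S1 = renamed ψ₁ e1 ff1 nw1 (SplitStep-cast (sym (rename-qu-≢ ne)) refl (step-split e S1))
  SplitStep-rename (step-↔ s e) ff nw with SplitStep-rename s ff nw
  ... | renamed ψ₁ e1 ff1 nw1 S1 = renamed ψ₁ (↔-sym e ⟫ e1) ff1 nw1 S1

  SplitStep-pushDown : ∀ {q'' x F1 F2 ψ} → x ∉ free F2 →
                       SplitStep (qu q'' x (bin (pConn q'') F1 F2)) ψ → SplitStep (bin (pConn q'') (qu q'' x F1) F2) ψ
  SplitStep-pushDown {q''} {x} {F1} {F2} nx s with SplitStep-qu⁻ s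
  ... | stepQu s' eψ with SplitStep-bin⁻ s'
  ...   | stepBinˡ s1 eψ1 = step-↔ (stepˡ (step-qu s1)) (↔-sym (eψ ⟫ ↔-qu eψ1 ⟫ ↔-root (pushDown q'' x _ F2 nx)))
  ...   | stepBinʳ s2 eψ2 = step-↔ (stepʳ s2) (↔-sym (eψ ⟫ ↔-qu eψ2 ⟫ ↔-root (pushDown q'' x F1 _ (SplitStep-∉ s2 nx))))
  SplitStep-pushDown {q''} {x} {F1} {F2} nx s | stepQuSplit e sC eψ with Distribute-bin⁻ sC
  ...   | distBinˡ e2 s1 n2 eψ1 = step-↔ (stepˡ (step-split e s1)) (↔-sym (eψ ⟫ eψ1))
  ...   | distBinʳ e2 s2 n1 eψ2 = ⊥-elim (nx (Distribute-∈ s2))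
  ...   | distBinSplit p _ _ = ⊥-elim (pConn≢pConn-dual q (trans (cong pConn (sym e)) (Split-spine p tt tt)))

  SplitStep-pullUp : ∀ {q'' x F1 F2 ψ} → x ∉ free F2 →
                     SplitStep (bin (pConn q'') (qu q'' x F1) F2) ψ → SplitStep (qu q'' x (bin (pConn q'') F1 F2)) ψ
  SplitStep-pullUp {q''} {x} {F1} {F2} nx s with SplitStep-bin⁻ s
  ... | stepBinʳ s2 eψ = step-↔ (step-qu (stepʳ s2)) (↔-sym (eψ ⟫ ↔-root (pullUp q'' x F1 _ (SplitStep-∉ s2 nx))))
  ... | stepBinˡ sL eψ with SplitStep-qu⁻ sL
  ...   | stepQu s1 eψ1 = step-↔ (step-qu (stepˡ s1)) (↔-sym (eψ ⟫ ↔-binˡ eψ1 ⟫ ↔-root (pullUp q'' x _ F2 nx)))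
  ...   | stepQuSplit e sC eψ1 = step-↔ (step-split e (distˡ (cong pConn e) sC nx)) (↔-sym (eψ ⟫ ↔-binˡ eψ1))

  SplitStep-RootT : ∀ {φ φ' ψ} → SplitStep φ ψ → RootT φ φ' → SplitStep φ' ψ
  SplitStep-RootT s (rA (assoc c F1 F2 F3)) with SplitStep-bin⁻ s
  ... | stepBinˡ s1 eψ = step-↔ (stepˡ (stepˡ s1)) (↔-sym (eψ ⟫ ↔-assoc c _ F2 F3))
  ... | stepBinʳ s23 eψ with SplitStep-bin⁻ s23
  ...   | stepBinˡ s2 eψ2 = step-↔ (stepˡ (stepʳ s2)) (↔-sym (eψ ⟫ ↔-binʳ eψ2 ⟫ ↔-assoc c F1 _ F3))
  ...   | stepBinʳ s3 eψ3 = step-↔ (stepʳ s3) (↔-sym (eψ ⟫ ↔-binʳ eψ3 ⟫ ↔-assoc c F1 F2 _))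
  SplitStep-RootT s (rA (assoc⁻ c F1 F2 F3)) with SplitStep-bin⁻ s
  ... | stepBinʳ s3 eψ = step-↔ (stepʳ (stepʳ s3)) (↔-sym (eψ ⟫ ↔-sym (↔-assoc c F1 F2 _)))
  ... | stepBinˡ s12 eψ with SplitStep-bin⁻ s12
  ...   | stepBinˡ s1 eψ1 = step-↔ (stepˡ s1) (↔-sym (eψ ⟫ ↔-binˡ eψ1 ⟫ ↔-sym (↔-assoc c _ F2 F3)))
  ...   | stepBinʳ s2 eψ2 = step-↔ (stepʳ (stepˡ s2)) (↔-sym (eψ ⟫ ↔-binˡ eψ2 ⟫ ↔-sym (↔-assoc c F1 _ F3)))
  SplitStep-RootT s (rC (comm c F1 F2)) with SplitStep-bin⁻ s
  ... | stepBinˡ s1 eψ = step-↔ (stepʳ s1) (↔-sym (eψ ⟫ ↔-comm c _ F2))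
  ... | stepBinʳ s2 eψ = step-↔ (stepˡ s2) (↔-sym (eψ ⟫ ↔-comm c F1 _))
  SplitStep-RootT s (rO (swap q' z y F)) with SplitStep-qu⁻ s
  ... | stepQuSplit e sC eψ with Distribute-qu⁻ sC
  ...   | distQu e2 yz s2 eψ2 = step-↔ (step-qu (step-split e s2)) (↔-sym (eψ ⟫ eψ2))
  ...   | distQuSplit p _ _ = ⊥-elim (q≢dual q (trans (sym e) (Split-spine p tt tt)))
  SplitStep-RootT s (rO (swap q' z y F)) | stepQu s' eψ with SplitStep-qu⁻ s'
  ...   | stepQu s2 eψ2 = step-↔ (step-qu (step-qu s2)) (↔-sym (eψ ⟫ ↔-qu eψ2 ⟫ ↔-swap q' z y _))
  ...   | stepQuSplit e sC eψ2 with z ≟ y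
  ...     | yes refl = s
  ...     | no zy = step-↔ (step-split e (dist-qu e zy sC)) (↔-sym (eψ ⟫ ↔-qu eψ2))
  SplitStep-RootT s (rPd (push∃ x F1 F2 nx)) = SplitStep-pushDown nx s
  SplitStep-RootT s (rPd (push∀ x F1 F2 nx)) = SplitStep-pushDown nx s
  SplitStep-RootT s (rPu (pull (push∃ x F1 F2 nx))) = SplitStep-pullUp nx s
  SplitStep-RootT s (rPu (pull (push∀ x F1 F2 nx))) = SplitStep-pullUp nx s
  SplitStep-RootT s (rN (ren q' z w A nw ff)) with SplitStep-qu⁻ s
  ... | stepQu s' eψ with SplitStep-rename s' ff nw
  ...   | renamed A₁ e1 ff1 nw1 S1 = step-↔ (step-qu S1) (↔-sym (eψ ⟫ ↔-qu e1 ⟫ ↔-rename q' z w A₁ nw1 ff1))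
  SplitStep-RootT s (rN (ren q' z w A nw ff)) | stepQuSplit e sC eψ = step-↔ (step-split e (Distribute-renameMarked sC ff nw)) (↔-sym eψ)

  SplitStep-→T : ∀ {φ φ' ψ} → SplitStep φ ψ → φ →T φ' → SplitStep φ' ψ
  SplitStep-→T s (here r) = SplitStep-RootT s r
  SplitStep-→T s (left st) with SplitStep-bin⁻ s
  ... | stepBinˡ s1 eψ = step-↔ (stepˡ (SplitStep-→T s1 st)) (↔-sym eψ)
  ... | stepBinʳ s2 eψ = step-↔ (stepʳ s2) (↔-sym (eψ ⟫ ↔-binˡ (↔-step st)))
  SplitStep-→T s (right st) with SplitStep-bin⁻ s
  ... | stepBinˡ s1 eψ = step-↔ (stepˡ s1) (↔-sym (eψ ⟫ ↔-binʳ (↔-step st)))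
  ... | stepBinʳ s2 eψ = step-↔ (stepʳ (SplitStep-→T s2 st)) (↔-sym eψ)
  SplitStep-→T s (under st) with SplitStep-qu⁻ s
  ... | stepQu s1 eψ = step-↔ (step-qu (SplitStep-→T s1 st)) (↔-sym eψ)
  ... | stepQuSplit e sC eψ = step-↔ (step-split e (Distribute-→T sC st)) (↔-sym eψ)

data Parent : Set where
  top : Parent
  binParent : Conn → Parent
  quParent : Quant → Parent

module Vacuous {σ : Signature} (q : Quant) where
  open Splitting {σ} q public

  -- A vacuous split has lost its binder, so nothing separates its spine from the context. Requiring
  -- that its parent is no spine node keeps moves at the parent from reaching into the spine.
  OffSpine : Parent → Set
  OffSpine top = ⊤
  OffSpine (binParent c) = c ≢ sConn
  OffSpine (quParent q') = q' ≢ dual q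

  -- vac-drop deletes a vacuous q-binder (rule M); vac-split is a split whose vacuous q-binder has
  -- already been deleted (rule S at a variable that does not occur).
  data VacuousStep : Parent → PFO σ → PFO σ → Set where
    vac-refl : ∀ {p} φ → VacuousStep p φ φ
    vac-bin : ∀ {p c A A' B B'} → VacuousStep (binParent c) A A' → VacuousStep (binParent c) B B' → VacuousStep p (bin c A B) (bin c A' B')
    vac-qu : ∀ {p q' y A A'} → VacuousStep (quParent q') A A' → VacuousStep p (qu q' y A) (qu q' y A')
    vac-drop : ∀ {p q' x A A'} → q' ≡ q → x ∉ free A → VacuousStep (quParent q') A A' → VacuousStep p (qu q' x A) A'
    vac-split : ∀ {p D X Y v} → OffSpine p → Split D (formula X) (formula Y) → v ∉ free D →
                VacuousStep p D (bin sConn (qu q v X) (qu q v Y))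
    vac-↔ : ∀ {p φ ψ ψ'} → VacuousStep p φ ψ → ψ ↔T ψ' → VacuousStep p φ ψ'

  VacuousStep-cast : ∀ {p A A' ψ ψ'} → A ≡ A' → ψ ≡ ψ' → VacuousStep p A ψ → VacuousStep p A' ψ'
  VacuousStep-cast refl refl s = s

  VacuousStep-reparent : ∀ {p p' φ ψ} → (OffSpine p → OffSpine p') → VacuousStep p φ ψ → VacuousStep p' φ ψ
  VacuousStep-reparent f (vac-refl φ) = vac-refl φ
  VacuousStep-reparent f (vac-bin s1 s2) = vac-bin s1 s2
  VacuousStep-reparent f (vac-qu s) = vac-qu s
  VacuousStep-reparent f (vac-drop e n s) = vac-drop e n s
  VacuousStep-reparent f (vac-split ok p n) = vac-split (f ok) p n
  VacuousStep-reparent f (vac-↔ s e) = vac-↔ (VacuousStep-reparent f s) e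

  VacuousStep-width : ∀ {p φ ψ} → VacuousStep p φ ψ → WidthBelow φ ψ
  VacuousStep-width (vac-refl φ) = WidthBelow-refl φ
  VacuousStep-width (vac-bin {c = c} s1 s2) = WidthBelow-bin c (VacuousStep-width s1) (VacuousStep-width s2)
  VacuousStep-width (vac-qu {q' = q'} {y} s) = WidthBelow-qu q' y (VacuousStep-width s)
  VacuousStep-width (vac-drop {q' = q'} {x} e x∉ s) =
    WidthBelow-bind q' x (VacuousStep-width s) (WidthBelow-∉ (VacuousStep-width s) x∉)
  VacuousStep-width (vac-split {v = v} ok p n) = split-width v p
  VacuousStep-width (vac-↔ s e) = WidthBelow-↔ (VacuousStep-width s) e

  VacuousStep-∉ : ∀ {p φ ψ u} → VacuousStep p φ ψ → u ∉ free φ → u ∉ free ψ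
  VacuousStep-∉ s = WidthBelow-∉ (VacuousStep-width s)

  data VacBin (p : Parent) (c : Conn) (A B ψ : PFO σ) : Set where
    vacBin : ∀ {A' B'} → VacuousStep (binParent c) A A' → VacuousStep (binParent c) B B' → ψ ↔T bin c A' B' → VacBin p c A B ψ
    vacBinSplit : ∀ {X Y v} → OffSpine p → Split (bin c A B) (formula X) (formula Y) → v ∉ free (bin c A B) →
          ψ ↔T bin sConn (qu q v X) (qu q v Y) → VacBin p c A B ψ

  VacuousStep-bin⁻ : ∀ {p c A B ψ} → VacuousStep p (bin c A B) ψ → VacBin p c A B ψ
  VacuousStep-bin⁻ (vac-refl _) = vacBin (vac-refl _) (vac-refl _) ↔-refl
  VacuousStep-bin⁻ (vac-bin s1 s2) = vacBin s1 s2 ↔-refl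
  VacuousStep-bin⁻ (vac-split ok p n) = vacBinSplit ok p n ↔-refl
  VacuousStep-bin⁻ (vac-↔ s e) with VacuousStep-bin⁻ s
  ... | vacBin a b d = vacBin a b (↔-sym e ⟫ d)
  ... | vacBinSplit a b c d = vacBinSplit a b c (↔-sym e ⟫ d)

  data VacQu (p : Parent) (q' : Quant) (y : Var) (A ψ : PFO σ) : Set where
    vacQu : ∀ {A'} → VacuousStep (quParent q') A A' → ψ ↔T qu q' y A' → VacQu p q' y A ψ
    vacQuDrop : ∀ {A'} → q' ≡ q → y ∉ free A → VacuousStep (quParent q') A A' → ψ ↔T A' → VacQu p q' y A ψ
    vacQuSplit : ∀ {X Y v} → OffSpine p → Split (qu q' y A) (formula X) (formula Y) → v ∉ free (qu q' y A) →
          ψ ↔T bin sConn (qu q v X) (qu q v Y) → VacQu p q' y A ψ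

  VacuousStep-qu⁻ : ∀ {p q' y A ψ} → VacuousStep p (qu q' y A) ψ → VacQu p q' y A ψ
  VacuousStep-qu⁻ (vac-refl _) = vacQu (vac-refl _) ↔-refl
  VacuousStep-qu⁻ (vac-qu s) = vacQu s ↔-refl
  VacuousStep-qu⁻ (vac-drop e n s) = vacQuDrop e n s ↔-refl
  VacuousStep-qu⁻ (vac-split ok p n) = vacQuSplit ok p n ↔-refl
  VacuousStep-qu⁻ (vac-↔ s e) with VacuousStep-qu⁻ s
  ... | vacQu a b = vacQu a (↔-sym e ⟫ b)
  ... | vacQuDrop a b c d = vacQuDrop a b c (↔-sym e ⟫ d)
  ... | vacQuSplit a b c d = vacQuSplit a b c (↔-sym e ⟫ d)

  vac-split-→T : ∀ {p D D'' X Y v ψ} → OffSpine p → Split D (formula X) (formula Y) → v ∉ free D →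
          ψ ↔T bin sConn (qu q v X) (qu q v Y) → D →T D'' → VacuousStep p D'' ψ
  vac-split-→T ok p nv e st = vac-↔ (vac-split ok (Split-→T p st) (↔T-∉ (↔-step st) nv)) (↔-sym e)

  VacuousStep-rename : ∀ {z w p A ψ} → VacuousStep p A ψ → FreeFor w z A → w ∉ free A → Renamed (VacuousStep p) z w A ψ
  VacuousStep-rename (vac-refl φ) ff nw = renamed φ ↔-refl ff nw (vac-refl _)
  VacuousStep-rename (vac-bin {c = c} {A} {A'} {B} {B'} s1 s2) (ffa , ffb) nw
    with VacuousStep-rename s1 ffa (∉-free-bin⁻ˡ A B nw) | VacuousStep-rename s2 ffb (∉-free-bin⁻ʳ A B nw)
  ... | renamed A₁ e1 f1 n1 S1 | renamed B₁ e2 f2 n2 S2 = renamed (bin c A₁ B₁) (↔-bin e1 e2) (f1 , f2) (∉-free-bin A₁ B₁ n1 n2) (vac-bin S1 S2)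
  VacuousStep-rename {z} {w} (vac-qu {q' = q'} {y} {A} s) ff nw with y ≟ z
  ... | yes refl = Renamed-∉ vac-↔ VacuousStep-width (vac-qu s) (bound∉freeExcept A) nw
  VacuousStep-rename {z} {w} (vac-qu {q' = q'} {y} {A} s) (inj₁ yz) nw | no ne = ⊥-elim (ne yz)
  VacuousStep-rename {z} {w} (vac-qu {q' = q'} {y} {A} s) (inj₂ (h , ffA)) nw | no ne with y ≟ w
  ... | yes refl = Renamed-∉ vac-↔ VacuousStep-width (vac-qu s) (∉-freeExcept A (h refl)) nw
  ... | no nyw with VacuousStep-rename s ffA (∉-freeExcept⁻ A nw (λ e → nyw (sym e)))
  ... | renamed ψ₁ e1 ff1 nw1 S1 =
    renamed (qu q' y ψ₁) (↔-qu e1) (inj₂ ((λ e → ⊥-elim (nyw e)) , ff1)) (∉-freeExcept ψ₁ nw1)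
       (VacuousStep-cast (sym (rename-qu-≢ ne)) (sym (rename-qu-≢ ne)) (vac-qu S1))
  VacuousStep-rename {z} {w} (vac-drop {q' = q'} {x} {A} e nx s) ff nw with x ≟ z
  ... | yes refl = Renamed-∉ vac-↔ VacuousStep-width (vac-drop e nx s) (bound∉freeExcept A) nw
  VacuousStep-rename {z} {w} (vac-drop {q' = q'} {x} {A} e nx s) (inj₁ xz) nw | no ne = ⊥-elim (ne xz)
  VacuousStep-rename {z} {w} (vac-drop {q' = q'} {x} {A} e nx s) (inj₂ (h , ffA)) nw | no ne with x ≟ w
  ... | yes refl = Renamed-∉ vac-↔ VacuousStep-width (vac-drop e nx s) (∉-freeExcept A (h refl)) nw
  ... | no nxw with VacuousStep-rename s ffA (∉-freeExcept⁻ A nw (λ e → nxw (sym e)))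
  ... | renamed ψ₁ e1 ff1 nw1 S1 =
    renamed ψ₁ e1 ff1 nw1 (VacuousStep-cast (sym (rename-qu-≢ ne)) refl (vac-drop e (∉-rename z w A nx nxw) S1))
  VacuousStep-rename {z} {w} (vac-split {D = D} {X} {Y} {v} ok p nv) ff nw with Split-rename p ff nw
  ... | renamedSplit r1 r2 e1 e2 f1 f2 pr with ≈-formula e1 | ≈-formula e2
  ... | (R1 , refl) | (R2 , refl) =
    renamed (bin sConn (qu q v' R1) (qu q v' R2))
       (↔-bin (↔-qu e1 ⟫ ↔-rename-vacuous q v v' R1 (λ m → nv (Split-∈₁ p e1 m)) (λ m → v'D (Split-∈₁ p e1 m)))
              (↔-qu e2 ⟫ ↔-rename-vacuous q v v' R2 (λ m → nv (Split-∈₂ p e2 m)) (λ m → v'D (Split-∈₂ p e2 m))))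
       (inj₂ ((λ e → ⊥-elim (v'w e)) , f1) , inj₂ ((λ e → ⊥-elim (v'w e)) , f2))
       (∉-free-bin (qu q v' R1) (qu q v' R2) (∉-freeExcept R1 (λ m → nw (Split-∈₁ p e1 m))) (∉-freeExcept R2 (λ m → nw (Split-∈₂ p e2 m))))
       (VacuousStep-cast refl (cong₂ (bin sConn) (sym (rename-qu-≢ v'z)) (sym (rename-qu-≢ v'z)))
          (vac-split ok pr (∉-rename z w D v'D v'w)))
    where
    open FreshFrom (freshFrom (free D) z w) renaming (var to v'; ∉L to v'D; ≢a to v'z; ≢b to v'w)
  VacuousStep-rename (vac-↔ s e) ff nw with VacuousStep-rename s ff nw
  ... | renamed ψ₁ e1 ff1 nw1 S1 = renamed ψ₁ (↔-sym e ⟫ e1) ff1 nw1 S1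

  VacuousStep-pushDown : ∀ {p q'' x F1 F2 ψ} → x ∉ free F2 → RootT (qu q'' x (bin (pConn q'') F1 F2)) (bin (pConn q'') (qu q'' x F1) F2) →
         VacuousStep p (qu q'' x (bin (pConn q'') F1 F2)) ψ → VacuousStep p (bin (pConn q'') (qu q'' x F1) F2) ψ
  VacuousStep-pushDown {p} {q''} {x} {F1} {F2} nx r s with VacuousStep-qu⁻ s
  ... | vacQuSplit ok pp nv eψ = vac-split-→T ok pp nv eψ (here r)
  ... | vacQu s' eψ with VacuousStep-bin⁻ s'
  ...   | vacBin s1 s2 eψ2 = vac-↔ (vac-bin (vac-qu (VacuousStep-reparent f s1)) s2) (↔-sym (eψ ⟫ ↔-qu eψ2 ⟫ ↔-root (pushDown q'' x _ _ (VacuousStep-∉ s2 nx))))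
    where
    f : OffSpine (binParent (pConn q'')) → OffSpine (quParent q'')
    f h e = h (cong pConn e)
  ...   | vacBinSplit ok pp _ _ = ⊥-elim (ok (pConn-injective (Split-spine pp tt tt)))
  VacuousStep-pushDown {p} {q''} {x} {F1} {F2} nx r s | vacQuDrop e nxA s' eψ with VacuousStep-bin⁻ s'
  ...   | vacBin s1 s2 eψ2 = vac-↔ (vac-bin (vac-drop e (∉-free-bin⁻ˡ F1 F2 nxA) (VacuousStep-reparent f s1)) s2) (↔-sym (eψ ⟫ eψ2))
    where
    f : OffSpine (binParent (pConn q'')) → OffSpine (quParent q'')
    f h e = h (cong pConn e)
  ...   | vacBinSplit ok pp _ _ = ⊥-elim (ok (pConn-injective (Split-spine pp tt tt)))

  VacuousStep-pullUp : ∀ {p q'' x F1 F2 ψ} → x ∉ free F2 → RootT (bin (pConn q'') (qu q'' x F1) F2) (qu q'' x (bin (pConn q'') F1 F2)) →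
         VacuousStep p (bin (pConn q'') (qu q'' x F1) F2) ψ → VacuousStep p (qu q'' x (bin (pConn q'') F1 F2)) ψ
  VacuousStep-pullUp {p} {q''} {x} {F1} {F2} nx r s with VacuousStep-bin⁻ s
  ... | vacBinSplit ok pp nv eψ = vac-split-→T ok pp nv eψ (here r)
  ... | vacBin sL s2 eψ with VacuousStep-qu⁻ sL
  ...   | vacQu s1 eψ1 = vac-↔ (vac-qu (vac-bin (VacuousStep-reparent g s1) s2)) (↔-sym (eψ ⟫ ↔-binˡ eψ1 ⟫ ↔-root (pullUp q'' x _ _ (VacuousStep-∉ s2 nx))))
    where
    g : OffSpine (quParent q'') → OffSpine (binParent (pConn q''))
    g h e = h (pConn-injective e)
  ...   | vacQuDrop e nx1 s1 eψ1 = vac-↔ (vac-drop e (∉-free-bin F1 F2 nx1 nx) (vac-bin (VacuousStep-reparent g s1) s2)) (↔-sym (eψ ⟫ ↔-binˡ eψ1))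
    where
    g : OffSpine (quParent q'') → OffSpine (binParent (pConn q''))
    g h e = h (pConn-injective e)
  ...   | vacQuSplit ok pp _ _ = ⊥-elim (ok (cong pConn (Split-spine pp tt tt)))

  VacuousStep-RootT : ∀ {p φ φ' ψ} → VacuousStep p φ ψ → RootT φ φ' → VacuousStep p φ' ψ
  VacuousStep-RootT s r@(rA (assoc c F1 F2 F3)) with VacuousStep-bin⁻ s
  ... | vacBinSplit ok pp nv eψ = vac-split-→T ok pp nv eψ (here r)
  ... | vacBin s1 s23 eψ with VacuousStep-bin⁻ s23
  ...   | vacBin s2 s3 eψ23 = vac-↔ (vac-bin (vac-bin s1 s2) s3) (↔-sym (eψ ⟫ ↔-binʳ eψ23 ⟫ ↔-assoc c _ _ _))
  ...   | vacBinSplit ok pp _ _ = ⊥-elim (ok (Split-spine pp tt tt))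
  VacuousStep-RootT s r@(rA (assoc⁻ c F1 F2 F3)) with VacuousStep-bin⁻ s
  ... | vacBinSplit ok pp nv eψ = vac-split-→T ok pp nv eψ (here r)
  ... | vacBin s12 s3 eψ with VacuousStep-bin⁻ s12
  ...   | vacBin s1 s2 eψ12 = vac-↔ (vac-bin s1 (vac-bin s2 s3)) (↔-sym (eψ ⟫ ↔-binˡ eψ12 ⟫ ↔-sym (↔-assoc c _ _ _)))
  ...   | vacBinSplit ok pp _ _ = ⊥-elim (ok (Split-spine pp tt tt))
  VacuousStep-RootT s r@(rC (comm c F1 F2)) with VacuousStep-bin⁻ s
  ... | vacBinSplit ok pp nv eψ = vac-split-→T ok pp nv eψ (here r)
  ... | vacBin s1 s2 eψ = vac-↔ (vac-bin s2 s1) (↔-sym (eψ ⟫ ↔-comm c _ _))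
  VacuousStep-RootT s r@(rO (swap q' z y F)) with VacuousStep-qu⁻ s
  ... | vacQuSplit ok pp nv eψ = vac-split-→T ok pp nv eψ (here r)
  ... | vacQu s' eψ with VacuousStep-qu⁻ s'
  ...   | vacQu s2 eψ2 = vac-↔ (vac-qu (vac-qu s2)) (↔-sym (eψ ⟫ ↔-qu eψ2 ⟫ ↔-swap q' z y _))
  ...   | vacQuDrop e ny s2 eψ2 = vac-↔ (vac-drop e (∉-freeExcept F ny) (vac-qu s2)) (↔-sym (eψ ⟫ ↔-qu eψ2))
  ...   | vacQuSplit ok pp _ _ = ⊥-elim (ok (Split-spine pp tt tt))
  VacuousStep-RootT s r@(rO (swap q' z y F)) | vacQuDrop e nz s' eψ with z ≟ y
  ...   | yes refl = s
  ...   | no zy with VacuousStep-qu⁻ s'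
  ...     | vacQu s2 eψ2 = vac-↔ (vac-qu (vac-drop e (∉-freeExcept⁻ F nz zy) s2)) (↔-sym (eψ ⟫ eψ2))
  ...     | vacQuDrop e2 ny s2 eψ2 = vac-↔ (vac-drop e2 (∉-freeExcept F ny) (vac-drop e (∉-freeExcept⁻ F nz zy) s2)) (↔-sym (eψ ⟫ eψ2))
  ...     | vacQuSplit ok pp _ _ = ⊥-elim (ok (Split-spine pp tt tt))
  VacuousStep-RootT s r@(rPd (push∃ x F1 F2 nx)) = VacuousStep-pushDown nx r s
  VacuousStep-RootT s r@(rPd (push∀ x F1 F2 nx)) = VacuousStep-pushDown nx r s
  VacuousStep-RootT s r@(rPu (pull (push∃ x F1 F2 nx))) = VacuousStep-pullUp nx r s
  VacuousStep-RootT s r@(rPu (pull (push∀ x F1 F2 nx))) = VacuousStep-pullUp nx r s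
  VacuousStep-RootT s r@(rN (ren q' z w A nw ff)) with VacuousStep-qu⁻ s
  ... | vacQuSplit ok pp nv eψ = vac-split-→T ok pp nv eψ (here r)
  ... | vacQu s' eψ with VacuousStep-rename s' ff nw
  ...   | renamed A₁ e1 ff1 nw1 S1 = vac-↔ (vac-qu S1) (↔-sym (eψ ⟫ ↔-qu e1 ⟫ ↔-rename q' z w A₁ nw1 ff1))
  VacuousStep-RootT s r@(rN (ren q' z w A nw ff)) | vacQuDrop e nz s' eψ =
    vac-↔ (VacuousStep-cast (cong (qu q' w) (sym (rename-∉ z w A nz))) refl (vac-drop e nw s')) (↔-sym eψ)

  VacuousStep-→T : ∀ {p φ φ' ψ} → VacuousStep p φ ψ → φ →T φ' → VacuousStep p φ' ψ
  VacuousStep-→T s (here r) = VacuousStep-RootT s r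
  VacuousStep-→T s (left st) with VacuousStep-bin⁻ s
  ... | vacBin s1 s2 eψ = vac-↔ (vac-bin (VacuousStep-→T s1 st) s2) (↔-sym eψ)
  ... | vacBinSplit ok pp nv eψ = vac-split-→T ok pp nv eψ (left st)
  VacuousStep-→T s (right st) with VacuousStep-bin⁻ s
  ... | vacBin s1 s2 eψ = vac-↔ (vac-bin s1 (VacuousStep-→T s2 st)) (↔-sym eψ)
  ... | vacBinSplit ok pp nv eψ = vac-split-→T ok pp nv eψ (right st)
  VacuousStep-→T s (under st) with VacuousStep-qu⁻ s
  ... | vacQu s1 eψ = vac-↔ (vac-qu (VacuousStep-→T s1 st)) (↔-sym eψ)
  ... | vacQuDrop e ny s1 eψ = vac-↔ (vac-drop e (↔T-∉ (↔-step st) ny) (VacuousStep-→T s1 st)) (↔-sym eψ)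
  ... | vacQuSplit ok pp nv eψ = vac-split-→T ok pp nv eψ (under st)

module _ {σ : Signature} where
  open Distribution using (SplitStep; step-split; dist-split; split-bin; allˡ; allʳ; stepˡ; stepʳ; step-qu; SplitStep-→T; SplitStep-width)
  open Vacuous using (VacuousStep; OffSpine; vac-drop; vac-split; vac-refl; vac-bin; vac-qu; VacuousStep-→T; VacuousStep-width)

  -- A vacuous step is required at every parent position, so that any context can be built around it.
  data GenStep (φ ψ : PFO σ) : Set where
    viaSplit   : ∀ q → SplitStep {σ} q φ ψ → GenStep φ ψ
    viaVacuous : ∀ q → (∀ p → VacuousStep {σ} q p φ ψ) → GenStep φ ψ

  RuleS⇒GenStep : ∀ q x (F1 F2 : PFO σ) → GenStep (qu q x (bin (pConn (dual q)) F1 F2)) (bin (pConn (dual q)) (qu q x F1) (qu q x F2))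
  RuleS⇒GenStep q x F1 F2 with x ∈? free (bin (pConn (dual q)) F1 F2)
  ... | yes m = viaSplit q (step-split refl (dist-split (split-bin refl (allˡ F1) (allʳ F2)) m))
  ... | no n = viaVacuous q (λ p → vac-drop refl n (vac-split (off-spine q) (split-bin refl (allˡ F1) (allʳ F2)) n))
    where
    off-spine : ∀ q → OffSpine {σ} q (quParent q)
    off-spine ∃' ()
    off-spine ∀' ()

  →SM⇒GenStep : ∀ {θ₁ θ₂ : PFO σ} → θ₁ →SM θ₂ → GenStep θ₁ θ₂
  →SM⇒GenStep (here (rS (split∃ x F1 F2))) = RuleS⇒GenStep ∃' x F1 F2
  →SM⇒GenStep (here (rS (split∀ x F1 F2))) = RuleS⇒GenStep ∀' x F1 F2
  →SM⇒GenStep (here (rM (drop q x F n))) = viaVacuous q (λ p → vac-drop refl n (vac-refl F))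
  →SM⇒GenStep (left {G = B} st) with →SM⇒GenStep st
  ... | viaSplit q s = viaSplit q (stepˡ s)
  ... | viaVacuous q f = viaVacuous q (λ p → vac-bin (f _) (vac-refl B))
  →SM⇒GenStep (right {F = A} st) with →SM⇒GenStep st
  ... | viaSplit q s = viaSplit q (stepʳ s)
  ... | viaVacuous q f = viaVacuous q (λ p → vac-bin (vac-refl A) (f _))
  →SM⇒GenStep (under st) with →SM⇒GenStep st
  ... | viaSplit q s = viaSplit q (step-qu s)
  ... | viaVacuous q f = viaVacuous q (λ p → vac-qu (f _))

  GenStep-→T : ∀ {φ φ' ψ : PFO σ} → GenStep φ ψ → φ →T φ' → GenStep φ' ψ
  GenStep-→T (viaSplit q s) st = viaSplit q (SplitStep-→T q s st)
  GenStep-→T (viaVacuous q f) st = viaVacuous q (λ p → VacuousStep-→T q (f p) st)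

  GenStep-↔T : ∀ {φ φ' ψ : PFO σ} → GenStep φ ψ → φ ↔T φ' → GenStep φ' ψ
  GenStep-↔T s ε = s
  GenStep-↔T s (fwd st ◅ r) = GenStep-↔T (GenStep-→T s st) r
  GenStep-↔T s (bwd st ◅ r) = GenStep-↔T (GenStep-→T s (→T-sym st)) r

  GenStep-width : ∀ {φ ψ : PFO σ} → GenStep φ ψ → WidthBelow φ ψ
  GenStep-width (viaSplit q s) = SplitStep-width q s
  GenStep-width (viaVacuous q f) = VacuousStep-width q (f top)

theorem4p5 : (σ : Signature) (θ₁ θ₂ : PFO σ) → θ₁ →SM θ₂ →
    (n₁ n₂ : ℕ) → IsInfWidth θ₁ n₁ → IsInfWidth θ₂ n₂ → n₁ ≥ n₂
theorem4p5 σ θ₁ θ₂ θ₁→θ₂ n₁ n₂ (_ , n₁-greatest) (n₂-lower , _) = n₁-greatest n₂ n₂-lower₁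
  where
  n₂-lower₁ : ∀ φ → θ₁ ↔T φ → n₂ ≤ width φ
  n₂-lower₁ φ θ₁↔φ with GenStep-width (GenStep-↔T (→SM⇒GenStep θ₁→θ₂) θ₁↔φ)
  ... | widthBelow ψ θ₂↔ψ ψ≤φ _ = NP.≤-trans (n₂-lower ψ θ₂↔ψ) ψ≤φ
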